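{- Let $n\geq1$, let $x_1,\dots,x_n$ be distinct variables, and let $\mathcal{S}\subseteq[3]^n$. The following are equivalent: (1) $\mathcal{S}$ meets the prime conditions; (2) there is a realization $\star$ such that $\mathbf{FIX}\Vdash_\star\bigwedge\{\lozenge\varepsilon_a: a\in\mathcal{S}\}\wedge\bigwedge\{\neg\lozenge\varepsilon_a: a\in[3]^n\setminus\mathcal{S}\}$.
   Context: Kripke fixed points. $\mathcal{L}_T$ is first-order arithmetic plus a unary predicate $\mathsf{True}$, with standard Gödel numbering $\ulcorner\cdot\urcorner$. Sentences are evaluated in strong Kleene logic $\mathsf{K3}$ (values \textsc{true}, \textsc{false}, \textsc{neither}; $\wedge$ true iff both true, false iff one false; $\neg$ swaps true/false; $\forall$ true iff all instances true, false iff some instance false; otherwise neither). For $S\subseteq\mathbb{N}$, $\mathbb{N}_S$ interprets arithmetic standardly and makes $\mathsf{True}(n)$ true iff $n\in S$, false iff $n$ is not a sentence code or $n=\ulcorner\varphi\urcorner$ with $\ulcorner\neg\varphi\urcorner\in S$, neither otherwise. A fixed point is a set $S$ of sentence codes with $S=\{\ulcorner\varphi\urcorner:\varphi\text{ true in }\mathbb{N}_S\}$ and no $\varphi$ with both $\ulcorner\varphi\urcorner,\ulcorner\neg\varphi\urcorner\in S$; values in $S$ are values in $\mathbb{N}_S$. $\mathbf{FIX}$ is the set of fixed points. Modal language and semantics. $\mathcal{L}_\Box$: formulas $\varphi::=T(x)\mid F(x)\mid\neg\varphi\mid(\varphi\wedge\varphi)\mid\Box\varphi$ over countably many variables; $\lozenge$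 etc. abbreviations; $N(x):=\neg T(x)\wedge\neg F(x)$. A realization $\star$ assigns each variable $x$ an $\mathcal{L}_T$ sentence $x^\star$. For $w\in\mathbf{FIX}$: $w\Vdash_\star T(x)$ iff $x^\star$ is \textsc{true} in $w$; $w\Vdash_\star F(x)$ iff $x^\star$ is \textsc{false} in $w$; Boolean connectives classical; $w\Vdash_\star\Box\varphi$ iff $v\Vdash_\star\varphi$ for all $v\in\mathbf{FIX}$. $\mathbf{FIX}\Vdash_\star\varphi$ means $w\Vdash_\star\varphi$ for all $w\in\mathbf{FIX}$. Tensors. $[3]^n$ is the set of $n$-tuples from $\{1,2,3\}$. Put $\chi_1:=T$, $\chi_2:=F$, $\chi_3:=N$, and for $a=(a_1,\dots,a_n)\in[3]^n$ let $\varepsilon_a:=\chi_{a_1}(x_1)\wedge\dots\wedge\chi_{a_n}(x_n)$. For $j\le n$ and $k\le 3$, the $k$-th layer of the $j$-th slice is $j_k:=\{a\in[3]^n: a_j=k\}$. A set $\mathcal{S}\subseteq[3]^n$ meets the prime conditions if: (1) $\mathcal{S}\neq\emptyset$; (2) for every $j\le n$, if $\mathcal{S}$ intersects both $j_1$ and $j_2$ then $\mathcal{S}$ intersects $j_3$; (3) for every $t\le n$ and any slices $s^1,\dots,s^t\in\{1,\dots,n\}$, if $\mathcal{S}$ intersects $s^i_3$ for each $i\le t$, then $\mathcal{S}$ intersects $s^1_3\cap\dots\cap s^t_3$. -}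

module Defs where

open import Level using (Level; Lift; lift) renaming (suc to lsuc; zero to lzero)
open import Data.Nat using (ℕ; zero; suc; _+_; _*_; _≤_)
open import Data.Fin using (Fin; toℕ) renaming (zero to fz; suc to fs)
open import Data.Vec using (Vec; []; _∷_; lookup)
open import Data.Bool using (Bool; true; false)
open import Data.Product using (Σ; ∃; _×_; _,_; proj₁)
open import Data.Sum using (_⊎_)
open import Data.Empty using (⊥)
open import Relation.Nullary using (¬_)
open import Relation.Binary.PropositionalEquality using (_≡_)

-- Formulas use de Bruijn indices; a formula of
-- type Formula k has (at most) k free variables.  Primitive connectives
-- are ¬, ∧, ∀ (the K3 clauses in the paper are given for these).

data Term (k : ℕ) : Set where
  tvar   : Fin k → Term k
  tzero  : Term k
  tsuc   : Term k → Term k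
  tplus  : Term k → Term k → Term k
  ttimes : Term k → Term k → Term k

data Formula (k : ℕ) : Set where
  _≐_   : Term k → Term k → Formula k
  True  : Term k → Formula k
  ¬'_   : Formula k → Formula k
  _∧'_  : Formula k → Formula k → Formula k
  ∀'_   : Formula (suc k) → Formula k

Sentence : Set
Sentence = Formula 0

tri : ℕ → ℕ
tri zero    = zero
tri (suc k) = suc k + tri k

pair : ℕ → ℕ → ℕ
pair a b = tri (a + b) + b

codeT : ∀ {k} → Term k → ℕ
codeT (tvar i)     = pair 0 (toℕ i)
codeT tzero        = pair 1 0
codeT (tsuc t)     = pair 2 (codeT t)
codeT (tplus s t)  = pair 3 (pair (codeT s) (codeT t))
codeT (ttimes s t) = pair 4 (pair (codeT s) (codeT t))

code : ∀ {k} → Formula k → ℕ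
code (s ≐ t)   = pair 0 (pair (codeT s) (codeT t))
code (True t)  = pair 1 (codeT t)
code (¬' φ)    = pair 2 (code φ)
code (φ ∧' ψ)  = pair 3 (pair (code φ) (code ψ))
code (∀' φ)    = pair 4 (code φ)

⌜_⌝ : Sentence → ℕ
⌜ φ ⌝ = code φ

IsSentCode : ℕ → Set
IsSentCode n = Σ Sentence (λ φ → ⌜ φ ⌝ ≡ n)

-- Strong Kleene evaluation in N_S (S ⊆ ℕ given as a predicate).
-- Tr S φ ρ : "φ has value true", Fa S φ ρ : "φ has value false"
-- under the assignment ρ of numbers to the free variables;
-- "neither" is the remaining case.

⟦_⟧ : ∀ {k} → Term k → Vec ℕ k → ℕ
⟦ tvar i ⟧     ρ = lookup ρ i
⟦ tzero ⟧      ρ = zero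
⟦ tsuc t ⟧     ρ = suc (⟦ t ⟧ ρ)
⟦ tplus s t ⟧  ρ = ⟦ s ⟧ ρ + ⟦ t ⟧ ρ
⟦ ttimes s t ⟧ ρ = ⟦ s ⟧ ρ * ⟦ t ⟧ ρ

mutual
  Tr : (ℕ → Set) → ∀ {k} → Formula k → Vec ℕ k → Set
  Tr S (s ≐ t)  ρ = ⟦ s ⟧ ρ ≡ ⟦ t ⟧ ρ
  Tr S (True t) ρ = S (⟦ t ⟧ ρ)
  Tr S (¬' φ)   ρ = Fa S φ ρ
  Tr S (φ ∧' ψ) ρ = Tr S φ ρ × Tr S ψ ρ
  Tr S (∀' φ)   ρ = (m : ℕ) → Tr S φ (m ∷ ρ)

  Fa : (ℕ → Set) → ∀ {k} → Formula k → Vec ℕ k → Set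
  Fa S (s ≐ t)  ρ = ¬ (⟦ s ⟧ ρ ≡ ⟦ t ⟧ ρ)
  Fa S (True t) ρ = ¬ IsSentCode (⟦ t ⟧ ρ)
                    ⊎ Σ Sentence (λ φ → (⌜ φ ⌝ ≡ ⟦ t ⟧ ρ) × S ⌜ ¬' φ ⌝)
  Fa S (¬' φ)   ρ = Tr S φ ρ
  Fa S (φ ∧' ψ) ρ = Fa S φ ρ ⊎ Fa S ψ ρ
  Fa S (∀' φ)   ρ = Σ ℕ (λ m → Fa S φ (m ∷ ρ))

TrueIn FalseIn : (ℕ → Set) → Sentence → Set
TrueIn  S φ = Tr S φ []
FalseIn S φ = Fa S φ []

record IsFixedPoint (S : ℕ → Set) : Set where
  field
    onlySentences : ∀ n → S n → IsSentCode n
    fixed         : ∀ (φ : Sentence) → (S ⌜ φ ⌝ → TrueIn S φ) × (TrueIn S φ → S ⌜ φ ⌝)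
    consistent    : ∀ (φ : Sentence) → ¬ (S ⌜ φ ⌝ × S ⌜ ¬' φ ⌝)

FIX : Set₁
FIX = Σ (ℕ → Set) IsFixedPoint

data MForm : Set where
  T F  : ℕ → MForm
  ¬ₘ_  : MForm → MForm
  _∧ₘ_ : MForm → MForm → MForm
  □_   : MForm → MForm

◇_ : MForm → MForm
◇ φ = ¬ₘ □ ¬ₘ φ

N : ℕ → MForm
N x = (¬ₘ T x) ∧ₘ (¬ₘ F x)

Realization : Set
Realization = ℕ → Sentence

_⊩[_]_ : FIX → Realization → MForm → Set₁
w ⊩[ ⋆ ] T x    = Lift (lsuc lzero) (TrueIn  (proj₁ w) (⋆ x))
w ⊩[ ⋆ ] F x    = Lift (lsuc lzero) (FalseIn (proj₁ w) (⋆ x))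
w ⊩[ ⋆ ] (¬ₘ φ)   = ¬ (w ⊩[ ⋆ ] φ)
w ⊩[ ⋆ ] (φ ∧ₘ ψ) = (w ⊩[ ⋆ ] φ) × (w ⊩[ ⋆ ] ψ)
w ⊩[ ⋆ ] (□ φ)    = (v : FIX) → v ⊩[ ⋆ ] φ

-- Tensors.  [3]^n = Vec (Fin 3) n, with 1,2,3 encoded as
-- fz, fs fz, fs (fs fz).

one two three : Fin 3
one   = fz
two   = fs fz
three = fs (fs fz)

χ : Fin 3 → ℕ → MForm
χ fz           = T
χ (fs fz)      = F
χ (fs (fs fz)) = N

⋀ : ∀ {k} → Vec MForm (suc k) → MForm
⋀ (φ ∷ [])     = φ
⋀ (φ ∷ ψ ∷ φs) = φ ∧ₘ ⋀ (ψ ∷ φs)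

ε : ∀ {n} → (Fin (suc n) → ℕ) → Vec (Fin 3) (suc n) → MForm
ε {n} x a = ⋀ (Data.Vec.tabulate (λ i → χ (lookup a i) (x i)))

record PrimeConditions {n : ℕ} (S : Vec (Fin 3) n → Bool) : Set where
  field
    nonempty : ∃ λ a → S a ≡ true
    slice    : ∀ (j : Fin n) →
               (∃ λ a → S a ≡ true × lookup a j ≡ one) →
               (∃ λ a → S a ≡ true × lookup a j ≡ two) →
               (∃ λ a → S a ≡ true × lookup a j ≡ three)
    neither  : ∀ (t : ℕ) → t ≤ n → (s : Fin t → Fin n) →
               (∀ i → ∃ λ a → S a ≡ true × lookup a (s i) ≡ three) →
               (∃ λ a → S a ≡ true × (∀ i → lookup a (s i) ≡ three))

{-# OPTIONS --safe #-}

-- A finite argument shows that S meets the prime conditions iff it has a least element c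
-- in the information order, where neither lies below true and false.
--
-- If a realization makes exactly the tensors of S possible, the tensor realized in
-- Kripke's least fixed point is such a c: it lies in S, and it is below every realized
-- tensor because truth and falsity in the least fixed point persist to all fixed points.
--
-- Conversely, diagonalization gives a liar sentence, neither in every fixed point, and
-- sentences κ v, one for each tensor v, each saying that it is the only true one among
-- them; for every v some fixed point makes κ v true and all the others false.  Let x j
-- say: some κ v with v ∈ S and v j = true is true, or else, unless some κ v with v ∈ S
-- and v j = false is true, a fixed sentence with the constant value c j.  In a fixed
-- point selecting v ∈ S this realizes v, and in every other fixed point it realizes c.

module Submission where

open import Defs
open import Level using (lift; lower)
open import Function using (_∘_; id)
open import Data.Nat
  using (ℕ; zero; suc; _+_; _*_; _∸_; _≤_; _<_; z≤n; s≤s; s≤s⁻¹; NonZero; _%_; _/_; _!; _≟_; _<?_)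
open import Data.Nat.Properties
open import Data.Nat.DivMod
open import Data.Nat.Divisibility
open import Data.Nat.Coprimality using (Coprime; coprime-Bézout; coprime-divisor; 1-coprimeTo)
open import Data.Nat.GCD using (module Bézout)
open import Data.Nat.Solver using (module +-*-Solver)
open import Data.Fin using (Fin; toℕ) renaming (zero to fz; suc to fs)
import Data.Fin.Properties as Finₚ
open import Data.Vec using (Vec; []; _∷_; lookup; tabulate)
open import Data.Vec.Properties using (tabulate∘lookup; lookup∘tabulate; tabulate-cong)
open import Data.Bool using (Bool; true; false)
import Data.Bool.Properties as Boolₚ
open import Data.Product using (Σ; ∃; _×_; _,_; proj₁; proj₂)
open import Data.Sum using (_⊎_; inj₁; inj₂; [_,_]′)
open import Data.Unit using (⊤)
open import Data.Empty using (⊥; ⊥-elim)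
open import Relation.Nullary using (¬_; Dec; yes; no; ¬?; contradiction)
open import Relation.Nullary.Decidable using (_×-dec_; _⊎-dec_; _→-dec_; decidable-stable; map′)
open import Relation.Binary.Definitions using (tri<; tri≈; tri>)
open import Relation.Binary.PropositionalEquality
open import Function.Definitions using (Injective)
open import Function.Bundles using (_⇔_; mk⇔)

tri-mono-≤ : ∀ {m n} → m ≤ n → tri m ≤ tri n
tri-mono-≤ z≤n       = z≤n
tri-mono-≤ (s≤s m≤n) = +-mono-≤ (s≤s m≤n) (tri-mono-≤ m≤n)

-- pair a b lies in [tri (a + b), tri (1 + a + b)), so it determines the diagonal a + b
pair-mono-diagonal : ∀ a b c d → a + b < c + d → pair a b < pair c d
pair-mono-diagonal a b c d lt = begin-strict
  tri (a + b) + b       ≤⟨ +-monoʳ-≤ (tri (a + b)) (m≤n+m b a) ⟩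
  tri (a + b) + (a + b) <⟨ s≤s (≤-reflexive (+-comm (tri (a + b)) (a + b))) ⟩
  tri (suc (a + b))     ≤⟨ tri-mono-≤ lt ⟩
  tri (c + d)           ≤⟨ m≤m+n (tri (c + d)) d ⟩
  tri (c + d) + d       ∎
  where open ≤-Reasoning

pair-injective : ∀ a b c d → pair a b ≡ pair c d → a ≡ c × b ≡ d
pair-injective a b c d eq = a≡c , b≡d
  where
  diagonal : a + b ≡ c + d
  diagonal with <-cmp (a + b) (c + d)
  ... | tri< lt _ _ = contradiction eq (<⇒≢ (pair-mono-diagonal a b c d lt))
  ... | tri≈ _ e _  = e
  ... | tri> _ _ gt = contradiction (sym eq) (<⇒≢ (pair-mono-diagonal c d a b gt))
  b≡d : b ≡ d
  b≡d = +-cancelˡ-≡ (tri (a + b)) b d (trans eq (cong (λ s → tri s + d) (sym diagonal)))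
  a≡c : a ≡ c
  a≡c = +-cancelʳ-≡ b a c (trans diagonal (cong (c +_) (sym b≡d)))

tagT : ∀ {k} → Term k → ℕ
tagT (tvar _)     = 0
tagT tzero        = 1
tagT (tsuc _)     = 2
tagT (tplus _ _)  = 3
tagT (ttimes _ _) = 4

bodyT : ∀ {k} → Term k → ℕ
bodyT (tvar i)     = toℕ i
bodyT tzero        = 0
bodyT (tsuc t)     = codeT t
bodyT (tplus s t)  = pair (codeT s) (codeT t)
bodyT (ttimes s t) = pair (codeT s) (codeT t)

codeT-tag-body : ∀ {k} (t : Term k) → codeT t ≡ pair (tagT t) (bodyT t)
codeT-tag-body (tvar _)     = refl
codeT-tag-body tzero        = refl
codeT-tag-body (tsuc _)     = refl
codeT-tag-body (tplus _ _)  = refl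
codeT-tag-body (ttimes _ _) = refl

codeT-injective : ∀ {k} {s t : Term k} → codeT s ≡ codeT t → s ≡ t
codeT-injective {s = s} {t} e = from-parts s t (proj₁ parts) (proj₂ parts)
  where
  parts : tagT s ≡ tagT t × bodyT s ≡ bodyT t
  parts = pair-injective (tagT s) (bodyT s) (tagT t) (bodyT t)
            (trans (sym (codeT-tag-body s)) (trans e (codeT-tag-body t)))
  from-parts : ∀ {k} (s t : Term k) → tagT s ≡ tagT t → bodyT s ≡ bodyT t → s ≡ t
  from-parts (tvar _)       (tvar _)       _ b = cong tvar (Finₚ.toℕ-injective b)
  from-parts tzero          tzero          _ _ = refl
  from-parts (tsuc _)       (tsuc _)       _ b = cong tsuc (codeT-injective b)
  from-parts (tplus s₁ s₂)  (tplus t₁ t₂)  _ b =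
    let (p , q) = pair-injective (codeT s₁) (codeT s₂) (codeT t₁) (codeT t₂) b
    in cong₂ tplus (codeT-injective p) (codeT-injective q)
  from-parts (ttimes s₁ s₂) (ttimes t₁ t₂) _ b =
    let (p , q) = pair-injective (codeT s₁) (codeT s₂) (codeT t₁) (codeT t₂) b
    in cong₂ ttimes (codeT-injective p) (codeT-injective q)
  from-parts (tvar _)       tzero          () _
  from-parts (tvar _)       (tsuc _)       () _
  from-parts (tvar _)       (tplus _ _)    () _
  from-parts (tvar _)       (ttimes _ _)   () _
  from-parts tzero          (tvar _)       () _
  from-parts tzero          (tsuc _)       () _
  from-parts tzero          (tplus _ _)    () _
  from-parts tzero          (ttimes _ _)   () _
  from-parts (tsuc _)       (tvar _)       () _
  from-parts (tsuc _)       tzero          () _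
  from-parts (tsuc _)       (tplus _ _)    () _
  from-parts (tsuc _)       (ttimes _ _)   () _
  from-parts (tplus _ _)    (tvar _)       () _
  from-parts (tplus _ _)    tzero          () _
  from-parts (tplus _ _)    (tsuc _)       () _
  from-parts (tplus _ _)    (ttimes _ _)   () _
  from-parts (ttimes _ _)   (tvar _)       () _
  from-parts (ttimes _ _)   tzero          () _
  from-parts (ttimes _ _)   (tsuc _)       () _
  from-parts (ttimes _ _)   (tplus _ _)    () _

tagF : ∀ {k} → Formula k → ℕ
tagF (_ ≐ _)  = 0
tagF (True _) = 1
tagF (¬' _)   = 2
tagF (_ ∧' _) = 3
tagF (∀' _)   = 4

bodyF : ∀ {k} → Formula k → ℕ
bodyF (s ≐ t)  = pair (codeT s) (codeT t)
bodyF (True t) = codeT t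
bodyF (¬' φ)   = code φ
bodyF (φ ∧' ψ) = pair (code φ) (code ψ)
bodyF (∀' φ)   = code φ

code-tag-body : ∀ {k} (φ : Formula k) → code φ ≡ pair (tagF φ) (bodyF φ)
code-tag-body (_ ≐ _)  = refl
code-tag-body (True _) = refl
code-tag-body (¬' _)   = refl
code-tag-body (_ ∧' _) = refl
code-tag-body (∀' _)   = refl

code-injective : ∀ {k} {φ ψ : Formula k} → code φ ≡ code ψ → φ ≡ ψ
code-injective {φ = φ} {ψ} e = from-parts φ ψ (proj₁ parts) (proj₂ parts)
  where
  parts : tagF φ ≡ tagF ψ × bodyF φ ≡ bodyF ψ
  parts = pair-injective (tagF φ) (bodyF φ) (tagF ψ) (bodyF ψ)
            (trans (sym (code-tag-body φ)) (trans e (code-tag-body ψ)))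
  from-parts : ∀ {k} (φ ψ : Formula k) → tagF φ ≡ tagF ψ → bodyF φ ≡ bodyF ψ → φ ≡ ψ
  from-parts (s₁ ≐ s₂) (t₁ ≐ t₂) _ b =
    let (p , q) = pair-injective (codeT s₁) (codeT s₂) (codeT t₁) (codeT t₂) b
    in cong₂ _≐_ (codeT-injective p) (codeT-injective q)
  from-parts (True _) (True _) _ b = cong True (codeT-injective b)
  from-parts (¬' _)   (¬' _)   _ b = cong ¬'_ (code-injective b)
  from-parts (φ₁ ∧' φ₂) (ψ₁ ∧' ψ₂) _ b =
    let (p , q) = pair-injective (code φ₁) (code φ₂) (code ψ₁) (code ψ₂) b
    in cong₂ _∧'_ (code-injective p) (code-injective q)
  from-parts (∀' _)   (∀' _)   _ b = cong ∀'_ (code-injective b)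
  from-parts (_ ≐ _)  (True _) () _
  from-parts (_ ≐ _)  (¬' _)   () _
  from-parts (_ ≐ _)  (_ ∧' _) () _
  from-parts (_ ≐ _)  (∀' _)   () _
  from-parts (True _) (_ ≐ _)  () _
  from-parts (True _) (¬' _)   () _
  from-parts (True _) (_ ∧' _) () _
  from-parts (True _) (∀' _)   () _
  from-parts (¬' _)   (_ ≐ _)  () _
  from-parts (¬' _)   (True _) () _
  from-parts (¬' _)   (_ ∧' _) () _
  from-parts (¬' _)   (∀' _)   () _
  from-parts (_ ∧' _) (_ ≐ _)  () _
  from-parts (_ ∧' _) (True _) () _
  from-parts (_ ∧' _) (¬' _)   () _
  from-parts (_ ∧' _) (∀' _)   () _
  from-parts (∀' _)   (_ ≐ _)  () _
  from-parts (∀' _)   (True _) () _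
  from-parts (∀' _)   (¬' _)   () _
  from-parts (∀' _)   (_ ∧' _) () _

mutual
  Tr-mono : ∀ {A B : ℕ → Set} → (∀ {n} → A n → B n) →
            ∀ {k} (φ : Formula k) ρ → Tr A φ ρ → Tr B φ ρ
  Tr-mono f (_ ≐ _)  ρ h       = h
  Tr-mono f (True _) ρ h       = f h
  Tr-mono f (¬' φ)   ρ h       = Fa-mono f φ ρ h
  Tr-mono f (φ ∧' ψ) ρ (g , h) = Tr-mono f φ ρ g , Tr-mono f ψ ρ h
  Tr-mono f (∀' φ)   ρ h       = λ m → Tr-mono f φ (m ∷ ρ) (h m)

  Fa-mono : ∀ {A B : ℕ → Set} → (∀ {n} → A n → B n) →
            ∀ {k} (φ : Formula k) ρ → Fa A φ ρ → Fa B φ ρ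
  Fa-mono f (_ ≐ _)  ρ h                  = h
  Fa-mono f (True _) ρ (inj₁ h)           = inj₁ h
  Fa-mono f (True _) ρ (inj₂ (ψ , e , h)) = inj₂ (ψ , e , f h)
  Fa-mono f (¬' φ)   ρ h                  = Tr-mono f φ ρ h
  Fa-mono f (φ ∧' ψ) ρ (inj₁ h)           = inj₁ (Fa-mono f φ ρ h)
  Fa-mono f (φ ∧' ψ) ρ (inj₂ h)           = inj₂ (Fa-mono f ψ ρ h)
  Fa-mono f (∀' φ)   ρ (m , h)            = m , Fa-mono f φ (m ∷ ρ) h

TrueFree : ∀ {k} → Formula k → Set
TrueFree (_ ≐ _)  = ⊤
TrueFree (True _) = ⊥
TrueFree (¬' φ)   = TrueFree φ
TrueFree (φ ∧' ψ) = TrueFree φ × TrueFree ψ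
TrueFree (∀' φ)   = TrueFree φ

mutual
  TrueFree-¬Tr×Fa : ∀ {A B : ℕ → Set} {k} (φ : Formula k) ρ → TrueFree φ →
                    Tr A φ ρ → ¬ Fa B φ ρ
  TrueFree-¬Tr×Fa (_ ≐ _)  ρ _       e       ne       = ne e
  TrueFree-¬Tr×Fa (¬' φ)   ρ tf      f       t        = TrueFree-¬Fa×Tr φ ρ tf f t
  TrueFree-¬Tr×Fa (φ ∧' ψ) ρ (p , _) (g , _) (inj₁ f) = TrueFree-¬Tr×Fa φ ρ p g f
  TrueFree-¬Tr×Fa (φ ∧' ψ) ρ (_ , q) (_ , h) (inj₂ f) = TrueFree-¬Tr×Fa ψ ρ q h f
  TrueFree-¬Tr×Fa (∀' φ)   ρ tf      h       (m , f)  = TrueFree-¬Tr×Fa φ (m ∷ ρ) tf (h m) f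

  TrueFree-¬Fa×Tr : ∀ {A B : ℕ → Set} {k} (φ : Formula k) ρ → TrueFree φ →
                    Fa A φ ρ → ¬ Tr B φ ρ
  TrueFree-¬Fa×Tr (_ ≐ _)  ρ _       ne       e       = ne e
  TrueFree-¬Fa×Tr (¬' φ)   ρ tf      t        f       = TrueFree-¬Tr×Fa φ ρ tf t f
  TrueFree-¬Fa×Tr (φ ∧' ψ) ρ (p , _) (inj₁ f) (g , _) = TrueFree-¬Fa×Tr φ ρ p f g
  TrueFree-¬Fa×Tr (φ ∧' ψ) ρ (_ , q) (inj₂ f) (_ , h) = TrueFree-¬Fa×Tr ψ ρ q f h
  TrueFree-¬Fa×Tr (∀' φ)   ρ tf      (m , f)  h       = TrueFree-¬Fa×Tr φ (m ∷ ρ) tf f (h m)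

module _ (w : FIX) where
  private
    Sw : ℕ → Set
    Sw = proj₁ w
    open IsFixedPoint (proj₂ w)

  ∈⇒true : ∀ φ → Sw ⌜ φ ⌝ → TrueIn Sw φ
  ∈⇒true φ = proj₁ (fixed φ)

  true⇒∈ : ∀ φ → TrueIn Sw φ → Sw ⌜ φ ⌝
  true⇒∈ φ = proj₂ (fixed φ)

  ¬true×false : ∀ φ → TrueIn Sw φ → ¬ FalseIn Sw φ
  ¬true×false φ t f = consistent φ (true⇒∈ φ t , true⇒∈ (¬' φ) f)

  false-via-True : ∀ φ {y} → y ≡ ⌜ φ ⌝ →
                   ¬ IsSentCode y ⊎ Σ Sentence (λ ψ → (⌜ ψ ⌝ ≡ y) × Sw ⌜ ¬' ψ ⌝) → FalseIn Sw φ
  false-via-True φ e (inj₁ ns) = ⊥-elim (ns (φ , sym e))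
  false-via-True φ e (inj₂ (ψ , e′ , s)) with code-injective {φ = ψ} {φ} (trans e′ e)
  ... | refl = ∈⇒true (¬' ψ) s

HasValue : FIX → Sentence → Fin 3 → Set
HasValue w φ fz           = TrueIn (proj₁ w) φ
HasValue w φ (fs fz)      = FalseIn (proj₁ w) φ
HasValue w φ (fs (fs fz)) = ¬ TrueIn (proj₁ w) φ × ¬ FalseIn (proj₁ w) φ

HasValue-unique : ∀ w φ {c d} → HasValue w φ c → HasValue w φ d → c ≡ d
HasValue-unique w φ {fz}           {fz}           _ _       = refl
HasValue-unique w φ {fz}           {fs fz}        t f       = ⊥-elim (¬true×false w φ t f)
HasValue-unique w φ {fz}           {fs (fs fz)}   t (nt , _) = ⊥-elim (nt t)
HasValue-unique w φ {fs fz}        {fz}           f t       = ⊥-elim (¬true×false w φ t f)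
HasValue-unique w φ {fs fz}        {fs fz}        _ _       = refl
HasValue-unique w φ {fs fz}        {fs (fs fz)}   f (_ , nf) = ⊥-elim (nf f)
HasValue-unique w φ {fs (fs fz)}   {fz}           (nt , _) t = ⊥-elim (nt t)
HasValue-unique w φ {fs (fs fz)}   {fs fz}        (_ , nf) f = ⊥-elim (nf f)
HasValue-unique w φ {fs (fs fz)}   {fs (fs fz)}   _ _       = refl

¬¬HasValue : ∀ w φ → ¬ ¬ Σ (Fin 3) (HasValue w φ)
¬¬HasValue w φ k = k (three , (λ t → k (one , t)) , (λ f → k (two , f)))


-- Kripke's least fixed point above a sound and consistent seed

module Closure
  (S₀ : ℕ → Set)
  (S₀-sentences : ∀ n → S₀ n → IsSentCode n)
  (S₀-sound : ∀ φ → S₀ ⌜ φ ⌝ → TrueIn S₀ φ)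
  (S₀-consistent : ∀ φ → S₀ ⌜ φ ⌝ → S₀ ⌜ ¬' φ ⌝ → ⊥)
  where

  -- TrD and FaD are Tr D and Fa D written out as inductive families,
  -- which makes the inductive definition of D strictly positive.
  mutual
    data D : ℕ → Set where
      seed : ∀ {n} → S₀ n → D n
      jump : (φ : Sentence) → TrD φ [] → D ⌜ φ ⌝

    data TrD : ∀ {k} → Formula k → Vec ℕ k → Set where
      t≐ : ∀ {k} {s t : Term k} {ρ} → ⟦ s ⟧ ρ ≡ ⟦ t ⟧ ρ → TrD (s ≐ t) ρ
      tTrue : ∀ {k} {t : Term k} {ρ} → D (⟦ t ⟧ ρ) → TrD (True t) ρ
      t¬ : ∀ {k} {φ : Formula k} {ρ} → FaD φ ρ → TrD (¬' φ) ρ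
      t∧ : ∀ {k} {φ ψ : Formula k} {ρ} → TrD φ ρ → TrD ψ ρ → TrD (φ ∧' ψ) ρ
      t∀ : ∀ {k} {φ : Formula (suc k)} {ρ} → ((m : ℕ) → TrD φ (m ∷ ρ)) → TrD (∀' φ) ρ

    data FaD : ∀ {k} → Formula k → Vec ℕ k → Set where
      f≐ : ∀ {k} {s t : Term k} {ρ} → ¬ (⟦ s ⟧ ρ ≡ ⟦ t ⟧ ρ) → FaD (s ≐ t) ρ
      fTrue-junk : ∀ {k} {t : Term k} {ρ} → ¬ IsSentCode (⟦ t ⟧ ρ) → FaD (True t) ρ
      fTrue : ∀ {k} {t : Term k} {ρ} (ψ : Sentence) → ⌜ ψ ⌝ ≡ ⟦ t ⟧ ρ → D ⌜ ¬' ψ ⌝ → FaD (True t) ρ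
      f¬ : ∀ {k} {φ : Formula k} {ρ} → TrD φ ρ → FaD (¬' φ) ρ
      f∧ˡ : ∀ {k} {φ ψ : Formula k} {ρ} → FaD φ ρ → FaD (φ ∧' ψ) ρ
      f∧ʳ : ∀ {k} {φ ψ : Formula k} {ρ} → FaD ψ ρ → FaD (φ ∧' ψ) ρ
      f∀ : ∀ {k} {φ : Formula (suc k)} {ρ} (m : ℕ) → FaD φ (m ∷ ρ) → FaD (∀' φ) ρ

  mutual
    TrD⇒Tr : ∀ {k} (φ : Formula k) ρ → TrD φ ρ → Tr D φ ρ
    TrD⇒Tr (_ ≐ _)  ρ (t≐ e)    = e
    TrD⇒Tr (True _) ρ (tTrue d) = d
    TrD⇒Tr (¬' φ)   ρ (t¬ f)    = FaD⇒Fa φ ρ f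
    TrD⇒Tr (φ ∧' ψ) ρ (t∧ g h)  = TrD⇒Tr φ ρ g , TrD⇒Tr ψ ρ h
    TrD⇒Tr (∀' φ)   ρ (t∀ h)    = λ m → TrD⇒Tr φ (m ∷ ρ) (h m)

    FaD⇒Fa : ∀ {k} (φ : Formula k) ρ → FaD φ ρ → Fa D φ ρ
    FaD⇒Fa (_ ≐ _)  ρ (f≐ e)         = e
    FaD⇒Fa (True _) ρ (fTrue-junk j) = inj₁ j
    FaD⇒Fa (True _) ρ (fTrue ψ e d)  = inj₂ (ψ , e , d)
    FaD⇒Fa (¬' φ)   ρ (f¬ t)         = TrD⇒Tr φ ρ t
    FaD⇒Fa (φ ∧' ψ) ρ (f∧ˡ f)        = inj₁ (FaD⇒Fa φ ρ f)
    FaD⇒Fa (φ ∧' ψ) ρ (f∧ʳ f)        = inj₂ (FaD⇒Fa ψ ρ f)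
    FaD⇒Fa (∀' φ)   ρ (f∀ m f)       = m , FaD⇒Fa φ (m ∷ ρ) f

  mutual
    Tr⇒TrD : ∀ {k} (φ : Formula k) ρ → Tr D φ ρ → TrD φ ρ
    Tr⇒TrD (_ ≐ _)  ρ e       = t≐ e
    Tr⇒TrD (True _) ρ d       = tTrue d
    Tr⇒TrD (¬' φ)   ρ f       = t¬ (Fa⇒FaD φ ρ f)
    Tr⇒TrD (φ ∧' ψ) ρ (g , h) = t∧ (Tr⇒TrD φ ρ g) (Tr⇒TrD ψ ρ h)
    Tr⇒TrD (∀' φ)   ρ h       = t∀ (λ m → Tr⇒TrD φ (m ∷ ρ) (h m))

    Fa⇒FaD : ∀ {k} (φ : Formula k) ρ → Fa D φ ρ → FaD φ ρ
    Fa⇒FaD (_ ≐ _)  ρ e                  = f≐ e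
    Fa⇒FaD (True _) ρ (inj₁ j)           = fTrue-junk j
    Fa⇒FaD (True _) ρ (inj₂ (ψ , e , d)) = fTrue ψ e d
    Fa⇒FaD (¬' φ)   ρ t                  = f¬ (Tr⇒TrD φ ρ t)
    Fa⇒FaD (φ ∧' ψ) ρ (inj₁ f)           = f∧ˡ (Fa⇒FaD φ ρ f)
    Fa⇒FaD (φ ∧' ψ) ρ (inj₂ f)           = f∧ʳ (Fa⇒FaD ψ ρ f)
    Fa⇒FaD (∀' φ)   ρ (m , f)            = f∀ m (Fa⇒FaD φ (m ∷ ρ) f)

  D-sentences : ∀ n → D n → IsSentCode n
  D-sentences n          (seed s)   = S₀-sentences n s
  D-sentences .(⌜ φ ⌝) (jump φ _) = φ , refl

  D-sound : ∀ φ → D ⌜ φ ⌝ → TrueIn D φ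
  D-sound φ d = sound d refl
    where
    sound : ∀ {n} → D n → ⌜ φ ⌝ ≡ n → TrueIn D φ
    sound (seed s)    e = Tr-mono seed φ [] (S₀-sound φ (subst S₀ (sym e) s))
    sound (jump ψ td) e with code-injective {φ = φ} {ψ} e
    ... | refl = TrD⇒Tr φ [] td

  -- Consistency is proved by simultaneous induction on the derivations of both
  -- members of a clashing pair; a seed member is handled through S₀-sound.
  mutual
    D-consistent : ∀ {n n′} → D n → D n′ → ∀ φ → n ≡ ⌜ φ ⌝ → n′ ≡ ⌜ ¬' φ ⌝ → ⊥
    D-consistent (seed s)    d′          φ e e′ = seed-clash s d′ φ e e′
    D-consistent (jump ψ td) (seed s′)   φ e e′ = clash-seed (jump ψ td) s′ φ e e′
    D-consistent (jump ψ td) (jump χ td′) φ e e′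
      with code-injective {φ = ψ} {φ} e | code-injective {φ = χ} {¬' φ} e′
    D-consistent (jump ψ td) (jump χ (t¬ fd)) φ e e′ | refl | refl = TrD×FaD td fd

    TrD×FaD : ∀ {k} {φ : Formula k} {ρ} → TrD φ ρ → FaD φ ρ → ⊥
    TrD×FaD (t≐ e)    (f≐ ne)         = ne e
    TrD×FaD (tTrue d) (fTrue-junk j)  = j (D-sentences _ d)
    TrD×FaD (tTrue d) (fTrue ψ e d′)  = D-consistent d d′ ψ (sym e) refl
    TrD×FaD (t¬ f)    (f¬ t)          = TrD×FaD t f
    TrD×FaD (t∧ g _)  (f∧ˡ f)         = TrD×FaD g f
    TrD×FaD (t∧ _ h)  (f∧ʳ f)         = TrD×FaD h f
    TrD×FaD (t∀ h)    (f∀ m f)        = TrD×FaD (h m) f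

    seed-clash : ∀ {n n′} → S₀ n → D n′ → ∀ φ → n ≡ ⌜ φ ⌝ → n′ ≡ ⌜ ¬' φ ⌝ → ⊥
    seed-clash s (seed s′)   φ e e′ = S₀-consistent φ (subst S₀ e s) (subst S₀ e′ s′)
    seed-clash s (jump χ td) φ e e′ with code-injective {φ = χ} {¬' φ} e′
    seed-clash s (jump χ (t¬ fd)) φ e e′ | refl = S₀Tr×FaD (S₀-sound φ (subst S₀ e s)) fd

    clash-seed : ∀ {n n′} → D n → S₀ n′ → ∀ φ → n ≡ ⌜ φ ⌝ → n′ ≡ ⌜ ¬' φ ⌝ → ⊥
    clash-seed (seed s)    s′ φ e e′ = S₀-consistent φ (subst S₀ e s) (subst S₀ e′ s′)
    clash-seed (jump ψ td) s′ φ e e′ with code-injective {φ = ψ} {φ} e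
    ... | refl = S₀Fa×TrD (S₀-sound (¬' φ) (subst S₀ e′ s′)) td

    S₀Tr×FaD : ∀ {k} {φ : Formula k} {ρ} → Tr S₀ φ ρ → FaD φ ρ → ⊥
    S₀Tr×FaD {φ = _ ≐ _}  e       (f≐ ne)        = ne e
    S₀Tr×FaD {φ = True _} s       (fTrue-junk j) = j (S₀-sentences _ s)
    S₀Tr×FaD {φ = True _} s       (fTrue ψ e d′) = seed-clash s d′ ψ (sym e) refl
    S₀Tr×FaD {φ = ¬' _}   f       (f¬ td)        = S₀Fa×TrD f td
    S₀Tr×FaD {φ = _ ∧' _} (g , _) (f∧ˡ f)        = S₀Tr×FaD g f
    S₀Tr×FaD {φ = _ ∧' _} (_ , h) (f∧ʳ f)        = S₀Tr×FaD h f
    S₀Tr×FaD {φ = ∀' _}   h       (f∀ m f)       = S₀Tr×FaD (h m) f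

    S₀Fa×TrD : ∀ {k} {φ : Formula k} {ρ} → Fa S₀ φ ρ → TrD φ ρ → ⊥
    S₀Fa×TrD {φ = _ ≐ _}  ne                 (t≐ e)    = ne e
    S₀Fa×TrD {φ = True _} (inj₁ j)           (tTrue d) = j (D-sentences _ d)
    S₀Fa×TrD {φ = True _} (inj₂ (ψ , e , s)) (tTrue d) = clash-seed d s ψ (sym e) refl
    S₀Fa×TrD {φ = ¬' _}   t                  (t¬ fd)   = S₀Tr×FaD t fd
    S₀Fa×TrD {φ = _ ∧' _} (inj₁ f)           (t∧ g _)  = S₀Fa×TrD f g
    S₀Fa×TrD {φ = _ ∧' _} (inj₂ f)           (t∧ _ h)  = S₀Fa×TrD f h
    S₀Fa×TrD {φ = ∀' _}   (m , f)            (t∀ h)    = S₀Fa×TrD f (h m)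

  fixpoint : FIX
  fixpoint = D , record
    { onlySentences = D-sentences
    ; fixed         = λ φ → D-sound φ , (λ t → jump φ (Tr⇒TrD φ [] t))
    ; consistent    = λ φ (d , d′) → D-consistent d d′ φ refl refl
    }

  seed-true : ∀ φ → S₀ ⌜ φ ⌝ → TrueIn D φ
  seed-true φ s = D-sound φ (seed s)

  module _ (v : FIX) (S₀⊆v : ∀ {n} → S₀ n → proj₁ v n) where
    mutual
      D⊆ : ∀ {n} → D n → proj₁ v n
      D⊆ (seed s)    = S₀⊆v s
      D⊆ (jump φ td) = true⇒∈ v φ (TrD⊆ td)

      TrD⊆ : ∀ {k} {φ : Formula k} {ρ} → TrD φ ρ → Tr (proj₁ v) φ ρ
      TrD⊆ (t≐ e)    = e
      TrD⊆ (tTrue d) = D⊆ d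
      TrD⊆ (t¬ f)    = FaD⊆ f
      TrD⊆ (t∧ g h)  = TrD⊆ g , TrD⊆ h
      TrD⊆ (t∀ h)    = λ m → TrD⊆ (h m)

      FaD⊆ : ∀ {k} {φ : Formula k} {ρ} → FaD φ ρ → Fa (proj₁ v) φ ρ
      FaD⊆ (f≐ e)         = e
      FaD⊆ (fTrue-junk j) = inj₁ j
      FaD⊆ (fTrue ψ e d)  = inj₂ (ψ , e , D⊆ d)
      FaD⊆ (f¬ t)         = TrD⊆ t
      FaD⊆ (f∧ˡ f)        = inj₁ (FaD⊆ f)
      FaD⊆ (f∧ʳ f)        = inj₂ (FaD⊆ f)
      FaD⊆ (f∀ m f)       = m , FaD⊆ f

∃' : ∀ {k} → Formula (suc k) → Formula k
∃' φ = ¬' (∀' (¬' φ))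

_∨'_ : ∀ {k} → Formula k → Formula k → Formula k
φ ∨' ψ = ¬' ((¬' φ) ∧' (¬' ψ))

_⇒'_ : ∀ {k} → Formula k → Formula k → Formula k
φ ⇒' ψ = ¬' (φ ∧' (¬' ψ))

v₀ : ∀ {k} → Term (suc k)
v₀ = tvar fz

v₁ : ∀ {k} → Term (suc (suc k))
v₁ = tvar (fs fz)

v₂ : ∀ {k} → Term (suc (suc (suc k)))
v₂ = tvar (fs (fs fz))

v₃ : ∀ {k} → Term (suc (suc (suc (suc k))))
v₃ = tvar (fs (fs (fs fz)))

v₄ : ∀ {k} → Term (suc (suc (suc (suc (suc k)))))
v₄ = tvar (fs (fs (fs (fs fz))))

wk : ∀ {k} → Term k → Term (suc k)
wk (tvar i)     = tvar (fs i)
wk tzero        = tzero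
wk (tsuc t)     = tsuc (wk t)
wk (tplus s t)  = tplus (wk s) (wk t)
wk (ttimes s t) = ttimes (wk s) (wk t)

⟦wk⟧ : ∀ {k} (t : Term k) m ρ → ⟦ wk t ⟧ (m ∷ ρ) ≡ ⟦ t ⟧ ρ
⟦wk⟧ (tvar i)     m ρ = refl
⟦wk⟧ tzero        m ρ = refl
⟦wk⟧ (tsuc t)     m ρ = cong suc (⟦wk⟧ t m ρ)
⟦wk⟧ (tplus s t)  m ρ = cong₂ _+_ (⟦wk⟧ s m ρ) (⟦wk⟧ t m ρ)
⟦wk⟧ (ttimes s t) m ρ = cong₂ _*_ (⟦wk⟧ s m ρ) (⟦wk⟧ t m ρ)

wk² : ∀ {k} → Term k → Term (suc (suc k))
wk² t = wk (wk t)

⟦wk²⟧ : ∀ {k} (t : Term k) m m′ ρ → ⟦ wk² t ⟧ (m ∷ m′ ∷ ρ) ≡ ⟦ t ⟧ ρ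
⟦wk²⟧ t m m′ ρ = trans (⟦wk⟧ (wk t) m (m′ ∷ ρ)) (⟦wk⟧ t m′ ρ)

num : ∀ {k} → ℕ → Term k
num zero    = tzero
num (suc n) = tsuc (num n)

⟦num⟧ : ∀ {k} n (ρ : Vec ℕ k) → ⟦ num n ⟧ ρ ≡ n
⟦num⟧ zero    ρ = refl
⟦num⟧ (suc n) ρ = cong suc (⟦num⟧ n ρ)

num-injective : ∀ {k} {m n} → num {k} m ≡ num n → m ≡ n
num-injective {k} {m} {n} e =
  trans (sym (⟦num⟧ m ρ)) (trans (cong (λ t → ⟦ t ⟧ ρ) e) (⟦num⟧ n ρ))
  where
  ρ : Vec ℕ k
  ρ = Data.Vec.replicate k 0

numCode : ℕ → ℕ
numCode zero    = pair 1 0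
numCode (suc n) = pair 2 (numCode n)

codeT-num : ∀ {k} n → codeT (num {k} n) ≡ numCode n
codeT-num zero    = refl
codeT-num (suc n) = cong (pair 2) (codeT-num n)

record Defines (S : ℕ → Set) {k} (φ : Formula k) (P : Vec ℕ k → Set) : Set where
  field
    sound    : ∀ ρ → Tr S φ ρ → P ρ
    complete : ∀ ρ → P ρ → Tr S φ ρ
    refute   : ∀ ρ → ¬ P ρ → Fa S φ ρ

¬×-splitˡ : ∀ {A B : Set} → Dec A → ¬ (A × B) → ¬ A ⊎ ¬ B
¬×-splitˡ (yes a) ¬ab = inj₂ (λ b → ¬ab (a , b))
¬×-splitˡ (no ¬a) _   = inj₁ ¬a

¬×-splitʳ : ∀ {A B : Set} → Dec B → ¬ (A × B) → ¬ A ⊎ ¬ B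
¬×-splitʳ (yes b) ¬ab = inj₁ (λ a → ¬ab (a , b))
¬×-splitʳ (no ¬b) _   = inj₂ ¬b

remainder-unique : ∀ q n r m .{{_ : NonZero n}} → q * n + r ≡ m → r < n → r ≡ m % n
remainder-unique q n r m eq r<n = sym (begin
  m % n           ≡⟨ %-congˡ (trans (sym eq) (+-comm (q * n) r)) ⟩
  (r + q * n) % n ≡⟨ [m+kn]%n≡m%n r q n ⟩
  r % n           ≡⟨ m<n⇒m%n≡m r<n ⟩
  r               ∎)
  where open ≡-Reasoning

2*pair : ∀ a b → 2 * pair a b ≡ (a + b) * suc (a + b) + 2 * b
2*pair a b = trans (*-distribˡ-+ 2 (tri (a + b)) b) (cong (_+ 2 * b) (2*tri (a + b)))
  where
  2*tri : ∀ n → 2 * tri n ≡ n * suc n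
  2*tri zero    = refl
  2*tri (suc n) = begin
    2 * (suc n + tri n)       ≡⟨ *-distribˡ-+ 2 (suc n) (tri n) ⟩
    2 * suc n + 2 * tri n     ≡⟨ cong (2 * suc n +_) (2*tri n) ⟩
    2 * suc n + n * suc n     ≡⟨ sym (*-distribʳ-+ (suc n) 2 n) ⟩
    (2 + n) * suc n           ≡⟨ *-comm (2 + n) (suc n) ⟩
    suc n * suc (suc n)       ∎
    where open ≡-Reasoning

β : ℕ → ℕ → ℕ → ℕ
β c d i = c % suc (suc i * d)

Less : ∀ {k} → Term k → Term k → Formula k
Less s t = ∃' (tplus (wk s) (tsuc v₀) ≐ wk t)

IsRem : ∀ {k} → Term k → Term k → Term k → Formula k
IsRem c m r = ∃' (tplus (ttimes v₀ (wk (tsuc m))) (wk r) ≐ wk c) ∧' Less r (tsuc m)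

IsBeta : ∀ {k} → Term k → Term k → Term k → Term k → Formula k
IsBeta c d i r = IsRem c (ttimes (tsuc i) d) r

IsPair : ∀ {k} → Term k → Term k → Term k → Formula k
IsPair a b y = ttimes (num 2) y ≐ tplus (ttimes (tplus a b) (tsuc (tplus a b))) (ttimes (num 2) b)


-- Gödel's β-function lemma

crt-from-bézout : ∀ A B a b x y .{{_ : NonZero A}} .{{_ : NonZero B}} → 1 + y * B ≡ x * A →
                  ∃ λ c → c % A ≡ a % A × c % B ≡ b % B
crt-from-bézout A B a b x y bézout = c , [m+kn]%n≡m%n a (e * x) A , c%B
  where
  e c : ℕ
  e = (B ∸ a % B) + b
  c = a + (e * x) * A
  -- Since x A = 1 + y B, c ≡ a + e ≡ b modulo B.
  c≡ : c ≡ b + (1 + a / B + e * y) * B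
  c≡ = begin
    a + (e * x) * A                             ≡⟨ cong (a +_) (*-assoc e x A) ⟩
    a + e * (x * A)                             ≡⟨ cong (λ z → a + e * z) (sym bézout) ⟩
    a + e * (1 + y * B)                         ≡⟨ cong (_+ e * (1 + y * B)) (m≡m%n+[m/n]*n a B) ⟩
    (a % B + (a / B) * B) + e * (1 + y * B)     ≡⟨ solve 5 (λ r q e y B →
                                                     (r :+ q :* B) :+ e :* (con 1 :+ y :* B)
                                                       := (r :+ e) :+ (q :+ e :* y) :* B)
                                                     refl (a % B) (a / B) e y B ⟩
    (a % B + e) + (a / B + e * y) * B           ≡⟨ cong (_+ (a / B + e * y) * B) a%B+e ⟩
    (B + b) + (a / B + e * y) * B               ≡⟨ solve 4 (λ B b q ey →
                                                     (B :+ b) :+ (q :+ ey) :* B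
                                                       := b :+ (con 1 :+ q :+ ey) :* B)
                                                     refl B b (a / B) (e * y) ⟩
    b + (1 + a / B + e * y) * B                 ∎
    where
    open ≡-Reasoning
    open +-*-Solver
    a%B+e : a % B + e ≡ B + b
    a%B+e = trans (sym (+-assoc (a % B) (B ∸ a % B) b)) (cong (_+ b) (m+[n∸m]≡n (m%n≤n a B)))
  c%B : c % B ≡ b % B
  c%B = trans (%-congˡ c≡) ([m+kn]%n≡m%n b (1 + a / B + e * y) B)

crt : ∀ A B .{{_ : NonZero A}} .{{_ : NonZero B}} → Coprime A B → ∀ a b →
      ∃ λ c → c % A ≡ a % A × c % B ≡ b % B
crt A B cop a b with coprime-Bézout cop
... | Bézout.+- x y eq = crt-from-bézout A B a b x y eq
... | Bézout.-+ x y eq with crt-from-bézout B A b a y x eq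
...   | c , p , q = c , q , p

coprime-*ˡ : ∀ {a b m} → Coprime a m → Coprime b m → Coprime (a * b) m
coprime-*ˡ {a} ca cb {g} (g∣ab , g∣m) = cb (coprime-divisor g⊥a g∣ab , g∣m)
  where
  g⊥a : Coprime g a
  g⊥a (h∣g , h∣a) = ca (h∣a , ∣-trans h∣g g∣m)

n≤n! : ∀ n → n ≤ n !
n≤n! zero    = z≤n
n≤n! (suc n) = begin
  suc n        ≡⟨ sym (*-identityʳ (suc n)) ⟩
  suc n * 1    ≤⟨ *-monoʳ-≤ (suc n) (1≤n! n) ⟩
  suc n * n !  ∎
  where open ≤-Reasoning

-- The moduli 1 + (1+i) d and 1 + (1+i+e) d are coprime once 1+e divides d:
-- a common divisor divides (1+i+e)(1 + (1+i) d) - (1+i)(1 + (1+i+e) d) = 1+e, hence d, hence 1.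
moduli-coprime : ∀ d i e → suc e ∣ d → Coprime (suc (suc i * d)) (suc (suc (i + suc e) * d))
moduli-coprime d i e 1+e∣d {g} (g∣mᵢ , g∣mⱼ) = ∣1⇒≡1 g∣1
  where
  open +-*-Solver
  identity : suc (i + suc e) * suc (suc i * d) ≡ suc i * suc (suc (i + suc e) * d) + suc e
  identity = solve 3 (λ i e d → (con 1 :+ (i :+ (con 1 :+ e))) :* (con 1 :+ (con 1 :+ i) :* d)
                       := (con 1 :+ i) :* (con 1 :+ (con 1 :+ (i :+ (con 1 :+ e))) :* d) :+ (con 1 :+ e))
                     refl i e d
  g∣1+e : g ∣ suc e
  g∣1+e = ∣m+n∣m⇒∣n (subst (g ∣_) identity (∣n⇒∣m*n (suc (i + suc e)) g∣mᵢ))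
                    (∣n⇒∣m*n (suc i) g∣mⱼ)
  g∣1 : g ∣ 1
  g∣1 = ∣m+n∣m⇒∣n (subst (g ∣_) (+-comm 1 (suc i * d)) g∣mᵢ)
                  (∣n⇒∣m*n (suc i) (∣-trans g∣1+e 1+e∣d))

-- The values f i for i ≤ z are encoded as the remainders of c modulo 1 + (1+i) d
-- with d = (B + z)!, which makes the moduli pairwise coprime and larger than every f i.
module β-encoding (f : ℕ → ℕ) (z B : ℕ) (f≤B : ∀ i → i ≤ z → f i ≤ B) where
  d : ℕ
  d = (B + z) !

  M : ℕ → ℕ
  M i = suc (suc i * d)

  Π : ℕ → ℕ
  Π zero    = 1
  Π (suc k) = Π k * M k

  Π-nonZero : ∀ k → NonZero (Π k)
  Π-nonZero zero    = _
  Π-nonZero (suc k) = m*n≢0 (Π k) (M k) {{Π-nonZero k}}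

  M-coprime : ∀ {i j} → i < j → j ≤ z → Coprime (M i) (M j)
  M-coprime {i} lt j≤z with m≤n⇒∃[o]m+o≡n lt
  ... | e , refl = subst (λ j → Coprime (M i) (M j)) (+-suc i e)
                     (moduli-coprime d i e (∣-trans (m∣m*n (e !)) (m≤n⇒m!∣n! 1+e≤B+z)))
    where
    1+e≤B+z : suc e ≤ B + z
    1+e≤B+z = ≤-trans (s≤s (m≤n+m e i)) (≤-trans j≤z (m≤n+m z B))

  M∣Π : ∀ {i k} → i < k → M i ∣ Π k
  M∣Π {i} {suc k} (s≤s i≤k) with m≤n⇒m<n∨m≡n i≤k
  ... | inj₂ refl = n∣m*n (Π k)
  ... | inj₁ i<k  = ∣m⇒∣m*n (M k) (M∣Π i<k)

  Π-coprime : ∀ {k j} → k ≤ j → j ≤ z → Coprime (Π k) (M j)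
  Π-coprime {zero}  _   _   = 1-coprimeTo _
  Π-coprime {suc k} k<j j≤z = coprime-*ˡ (Π-coprime (<⇒≤ k<j) j≤z) (M-coprime k<j j≤z)

  f<M : ∀ {i} → i ≤ z → f i < M i
  f<M {i} i≤z = s≤s (≤-trans (f≤B i i≤z)
                     (≤-trans (m≤m+n B z) (≤-trans (n≤n! (B + z)) (m≤n*m d (suc i)))))

  encode : ∀ k → k ≤ suc z → ∃ λ c → ∀ i → i < k → c % M i ≡ f i
  encode zero    _   = 0 , λ _ ()
  encode (suc k) k<z with encode k (<⇒≤ k<z)
  ... | c , c-ok with crt (Π k) (M k) {{Π-nonZero k}} (Π-coprime ≤-refl (s≤s⁻¹ k<z)) c (f k)
  ...   | c′ , c′≡c , c′≡fk = c′ , c′-ok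
    where
    instance
      Πk-nonZero : NonZero (Π k)
      Πk-nonZero = Π-nonZero k
    c′-ok : ∀ i → i < suc k → c′ % M i ≡ f i
    c′-ok i (s≤s i≤k) with m≤n⇒m<n∨m≡n i≤k
    ... | inj₂ refl = trans c′≡fk (m<n⇒m%n≡m (f<M (s≤s⁻¹ k<z)))
    ... | inj₁ i<k  = begin
      c′ % M i          ≡⟨ m∣n⇒o%n%m≡o%m (M i) (Π k) c′ (M∣Π i<k) ⟨
      c′ % Π k % M i    ≡⟨ cong (_% M i) c′≡c ⟩
      c % Π k % M i     ≡⟨ m∣n⇒o%n%m≡o%m (M i) (Π k) c (M∣Π i<k) ⟩
      c % M i           ≡⟨ c-ok i i<k ⟩
      f i               ∎
      where open ≡-Reasoning

β-lemma : ∀ (f : ℕ → ℕ) z B → (∀ i → i ≤ z → f i ≤ B) →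
          ∃ λ c → ∃ λ d → ∀ i → i ≤ z → β c d i ≡ f i
β-lemma f z B f≤B with β-encoding.encode f z B f≤B (suc z) ≤-refl
... | c , c-ok = c , (B + z) ! , λ i i≤z → c-ok i (s≤s i≤z)
-- Opaque copies of pair and code: codes of concrete formulas must be compared at this
-- level, since unfolding pair would expand them into enormous unary numerals.
opaque
  pairᵒ : ℕ → ℕ → ℕ
  pairᵒ = pair

  pairᵒ≡pair : ∀ a b → pairᵒ a b ≡ pair a b
  pairᵒ≡pair a b = refl

  codeᵒ : ∀ {k} → Formula k → ℕ
  codeᵒ = code

  codeᵒ≡code : ∀ {k} (φ : Formula k) → codeᵒ φ ≡ code φ
  codeᵒ≡code φ = refl

record NumCodeTrace (c d z w : ℕ) : Set where
  field
    β-zero : 1 ≡ β c d 0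
    β-last : w ≡ β c d z
    β-step : ∀ i → i < z → β c d (suc i) ≡ pair 2 (β c d i)

trace⇒numCode : ∀ {c d z w} → NumCodeTrace c d z w → w ≡ numCode z
trace⇒numCode {c} {d} {z} trace = trans β-last (βᵢ z ≤-refl)
  where
  open NumCodeTrace trace
  βᵢ : ∀ i → i ≤ z → β c d i ≡ numCode i
  βᵢ zero    _   = sym β-zero
  βᵢ (suc i) i<z = trans (β-step i i<z) (cong (pair 2) (βᵢ i (<⇒≤ i<z)))

numCode-mono-≤ : ∀ {i j} → i ≤ j → numCode i ≤ numCode j
numCode-mono-≤ {i} {j} i≤j with m≤n⇒m<n∨m≡n i≤j
... | inj₂ refl = ≤-refl
numCode-mono-≤ {i} {suc j} _ | inj₁ (s≤s i≤j) =
  ≤-trans (numCode-mono-≤ i≤j) (m≤n+m (numCode j) (tri (2 + numCode j)))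

numCode-trace : ∀ z → ∃ λ c → ∃ λ d → NumCodeTrace c d z (numCode z)
numCode-trace z with β-lemma numCode z (numCode z) (λ _ → numCode-mono-≤)
... | c , d , β≡ = c , d , record
  { β-zero = sym (β≡ 0 z≤n)
  ; β-last = sym (β≡ z ≤-refl)
  ; β-step = λ i i<z → trans (β≡ (suc i) i<z) (cong (pair 2) (sym (β≡ i (<⇒≤ i<z))))
  }

NumCodeStep : ∀ {k} → Formula (suc (suc (suc k)))
NumCodeStep = ∃' (∃' (IsBeta v₄ v₃ v₂ v₁ ∧' (IsBeta v₄ v₃ (tsuc v₂) v₀ ∧' IsPair (num 2) v₁ v₀)))

IsNumCode : ∀ {k} → Term k → Term k → Formula k
IsNumCode z w = ∃' (∃' (IsBeta v₁ v₀ (num 0) (num 1) ∧'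
                        (IsBeta v₁ v₀ (wk² z) (wk² w) ∧' (∀' (Less v₀ (wk (wk² z)) ⇒' NumCodeStep)))))

data PairExpr (k : ℕ) : Set where
  leaf : Term k → PairExpr k
  node : PairExpr k → PairExpr k → PairExpr k

⟦_⟧ᴾ : ∀ {k} → PairExpr k → Vec ℕ k → ℕ
⟦ leaf t ⟧ᴾ   ρ = ⟦ t ⟧ ρ
⟦ node a b ⟧ᴾ ρ = pairᵒ (⟦ a ⟧ᴾ ρ) (⟦ b ⟧ᴾ ρ)

-- The leaves are read through f, which accumulates the weakenings under the binders
-- introduced for the intermediate values.
IsPairExprVia : ∀ {k k′} → (Term k → Term k′) → PairExpr k → Term k′ → Formula k′
IsPairExprVia f (leaf t)   y = y ≐ f t
IsPairExprVia f (node a b) y =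
  ∃' (∃' (IsPairExprVia (wk² ∘ f) a v₁ ∧' (IsPairExprVia (wk² ∘ f) b v₀ ∧' IsPair v₁ v₀ (wk² y))))

IsPairExpr : ∀ {k} → PairExpr k → Term k → Formula k
IsPairExpr = IsPairExprVia id

codeOf∃ : ℕ → ℕ
codeOf∃ c = pairᵒ 2 (pairᵒ 4 (pairᵒ 2 c))

codeOf∧ : ℕ → ℕ → ℕ
codeOf∧ a b = pairᵒ 3 (pairᵒ a b)

codeOfv₀≐ : ℕ → ℕ
codeOfv₀≐ t = pairᵒ 0 (pairᵒ (pairᵒ 0 0) t)

-- Each of the following equations unfolds a single constructor of code, so that the
-- two sides agree syntactically after one reduction step.
code-¬ : ∀ {k} (φ : Formula k) → code (¬' φ) ≡ pairᵒ 2 (code φ)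
code-¬ φ = sym (pairᵒ≡pair 2 (code φ))

code-∀ : ∀ {k} (φ : Formula (suc k)) → code (∀' φ) ≡ pairᵒ 4 (code φ)
code-∀ φ = sym (pairᵒ≡pair 4 (code φ))

code-∃ : ∀ {k} (φ : Formula (suc k)) → code (∃' φ) ≡ codeOf∃ (code φ)
code-∃ φ = trans (code-¬ (∀' (¬' φ))) (cong (pairᵒ 2) (trans (code-∀ (¬' φ)) (cong (pairᵒ 4) (code-¬ φ))))

code-∧ : ∀ {k} (φ ψ : Formula k) → code (φ ∧' ψ) ≡ codeOf∧ (code φ) (code ψ)
code-∧ φ ψ =
  sym (trans (pairᵒ≡pair 3 (pairᵒ (code φ) (code ψ))) (cong (pair 3) (pairᵒ≡pair (code φ) (code ψ))))

code-v₀≐ : ∀ {k} (t : Term (suc k)) → code (v₀ ≐ t) ≡ codeOfv₀≐ (codeT t)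
code-v₀≐ t = sym (trans (pairᵒ≡pair 0 (pairᵒ (pairᵒ 0 0) (codeT t)))
               (cong (pair 0) (trans (pairᵒ≡pair (pairᵒ 0 0) (codeT t))
                                     (cong (λ z → pair z (codeT t)) (pairᵒ≡pair 0 0)))))

diagCode : ℕ → ℕ → ℕ → ℕ
diagCode h a i = codeOf∃ (codeOf∧ (codeOfv₀≐ a) (codeOf∃ (codeOf∧ (codeOfv₀≐ i) h)))

-- H sees t₁ as v₁ and t₂ as v₀.
instantiate : Formula 2 → Term 1 → Term 2 → Sentence
instantiate H t₁ t₂ = ∃' ((v₀ ≐ t₁) ∧' ∃' ((v₀ ≐ t₂) ∧' H))

-- Stated for arbitrary terms: with concrete ones the two sides would differ in the
-- representation of implicit indices, and comparing them would unfold pair.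
instantiate-code : ∀ H t₁ t₂ → ⌜ instantiate H t₁ t₂ ⌝ ≡ diagCode (code H) (codeT t₁) (codeT t₂)
instantiate-code H t₁ t₂ =
  trans (code-∃ {0} ((v₀ ≐ t₁) ∧' ∃' ((v₀ ≐ t₂) ∧' H)))
    (cong codeOf∃ (trans (code-∧ {1} (v₀ ≐ t₁) (∃' ((v₀ ≐ t₂) ∧' H)))
      (cong₂ codeOf∧ (code-v₀≐ {0} t₁)
        (trans (code-∃ {1} ((v₀ ≐ t₂) ∧' H))
          (cong codeOf∃ (trans (code-∧ {2} (v₀ ≐ t₂) H)
                                (cong (λ c → codeOf∧ c (code H)) (code-v₀≐ {1} t₂))))))))

diag : Formula 2 → ℕ → ℕ → Sentence
diag H a i = instantiate H (num a) (num i)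

diag-code : ∀ H a i → ⌜ diag H a i ⌝ ≡ diagCode (code H) (numCode a) (numCode i)
diag-code H a i = trans (instantiate-code H (num a) (num i)) (cong₂ (diagCode (code H)) (codeT-num a) (codeT-num i))

#ᴾ : ∀ {k} → ℕ → PairExpr k
#ᴾ n = leaf (num n)

diagCodeᴾ : ∀ {k} → PairExpr k → PairExpr k → PairExpr k → PairExpr k
diagCodeᴾ h a i = ∃ᴾ (∧ᴾ (v₀≐ᴾ a) (∃ᴾ (∧ᴾ (v₀≐ᴾ i) h)))
  where
  ∃ᴾ : ∀ {k} → PairExpr k → PairExpr k
  ∃ᴾ c = node (#ᴾ 2) (node (#ᴾ 4) (node (#ᴾ 2) c))
  ∧ᴾ : ∀ {k} → PairExpr k → PairExpr k → PairExpr k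
  ∧ᴾ a b = node (#ᴾ 3) (node a b)
  v₀≐ᴾ : ∀ {k} → PairExpr k → PairExpr k
  v₀≐ᴾ t = node (#ᴾ 0) (node (node (#ᴾ 0) (#ᴾ 0)) t)

-- ⌜ diag H a j ⌝ for a = ⌜ H ⌝, computed from a alone (see σ-code).
σCode : ℕ → ℕ → ℕ
σCode a j = diagCode a (numCode a) (numCode j)

-- Opaque so that Tr S (IsσCode a j y) ρ is never unfolded when comparing types.
opaque
  IsσCode : ∀ {k} → Term k → Term k → Term k → Formula k
  IsσCode a j y = ∃' (∃' (IsNumCode (wk² a) v₁ ∧' (IsNumCode (wk² j) v₀ ∧'
                          IsPairExpr (diagCodeᴾ (leaf (wk² a)) (leaf v₁) (leaf v₀)) (wk² y))))

  IsσCode-TrueFree : ∀ {k} (a j y : Term k) → TrueFree (IsσCode a j y)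
  IsσCode-TrueFree a j y = _
module Definability (S : ℕ → Set) where
  open Defines

  ≐-defines : ∀ {k} (s t : Term k) → Defines S (s ≐ t) (λ ρ → ⟦ s ⟧ ρ ≡ ⟦ t ⟧ ρ)
  ≐-defines s t = record { sound = λ _ → id ; complete = λ _ → id ; refute = λ _ → id }

  ∧-defines : ∀ {k} {φ ψ : Formula k} {P Q : Vec ℕ k → Set} →
              Defines S φ P → Defines S ψ Q → (∀ ρ → ¬ (P ρ × Q ρ) → ¬ P ρ ⊎ ¬ Q ρ) →
              Defines S (φ ∧' ψ) (λ ρ → P ρ × Q ρ)
  ∧-defines dφ dψ split = record
    { sound    = λ ρ (p , q) → sound dφ ρ p , sound dψ ρ q
    ; complete = λ ρ (p , q) → complete dφ ρ p , complete dψ ρ q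
    ; refute   = λ ρ ¬pq → Data.Sum.map (refute dφ ρ) (refute dψ ρ) (split ρ ¬pq)
    }

  ∃-defines : ∀ {k} {φ : Formula (suc k)} {P : Vec ℕ (suc k) → Set} →
              Defines S φ P → Defines S (∃' φ) (λ ρ → ∃ λ m → P (m ∷ ρ))
  ∃-defines dφ = record
    { sound    = λ ρ (m , t) → m , sound dφ (m ∷ ρ) t
    ; complete = λ ρ (m , p) → m , complete dφ (m ∷ ρ) p
    ; refute   = λ ρ ¬p m → refute dφ (m ∷ ρ) (λ p → ¬p (m , p))
    }

  ⇔-defines : ∀ {k} {φ : Formula k} {P Q : Vec ℕ k → Set} →
              (∀ {ρ} → P ρ → Q ρ) → (∀ {ρ} → Q ρ → P ρ) → Defines S φ P → Defines S φ Q
  ⇔-defines to from dφ = record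
    { sound    = λ ρ t → to (sound dφ ρ t)
    ; complete = λ ρ q → complete dφ ρ (from q)
    ; refute   = λ ρ ¬q → refute dφ ρ (λ p → ¬q (to p))
    }

  Less-defines : ∀ {k} (s t : Term k) → Defines S (Less s t) (λ ρ → ⟦ s ⟧ ρ < ⟦ t ⟧ ρ)
  Less-defines s t = ⇔-defines to from (∃-defines (≐-defines _ _))
    where
    to : ∀ {ρ} → (∃ λ m → ⟦ wk s ⟧ (m ∷ ρ) + suc m ≡ ⟦ wk t ⟧ (m ∷ ρ)) → ⟦ s ⟧ ρ < ⟦ t ⟧ ρ
    to {ρ} (m , e) rewrite ⟦wk⟧ s m ρ | ⟦wk⟧ t m ρ = subst (⟦ s ⟧ ρ <_) e (m<m+n (⟦ s ⟧ ρ) (s≤s z≤n))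
    from : ∀ {ρ} → ⟦ s ⟧ ρ < ⟦ t ⟧ ρ → ∃ λ m → ⟦ wk s ⟧ (m ∷ ρ) + suc m ≡ ⟦ wk t ⟧ (m ∷ ρ)
    from {ρ} lt with m≤n⇒∃[o]m+o≡n lt
    ... | m , e = m , trans (cong (_+ suc m) (⟦wk⟧ s m ρ))
                            (trans (+-suc (⟦ s ⟧ ρ) m) (trans e (sym (⟦wk⟧ t m ρ))))

  defines-refuted : ∀ {k} {φ : Formula k} {P : Vec ℕ k → Set} → TrueFree φ → Defines S φ P →
                    ∀ ρ → Fa S φ ρ → ¬ P ρ
  defines-refuted {φ = φ} tf dφ ρ f p = TrueFree-¬Fa×Tr {S} {S} φ ρ tf f (complete dφ ρ p)

  IsRem-defines : ∀ {k} (c m r : Term k) →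
                  Defines S (IsRem c m r) (λ ρ → ⟦ r ⟧ ρ ≡ ⟦ c ⟧ ρ % suc (⟦ m ⟧ ρ))
  IsRem-defines {k} c m r = ⇔-defines to from
    (∧-defines (∃-defines (≐-defines _ _)) (Less-defines r (tsuc m))
      (λ ρ → ¬×-splitʳ (⟦ r ⟧ ρ <? suc (⟦ m ⟧ ρ))))
    where
    Quotient : Vec ℕ k → Set
    Quotient ρ = ∃ λ q → q * ⟦ wk (tsuc m) ⟧ (q ∷ ρ) + ⟦ wk r ⟧ (q ∷ ρ) ≡ ⟦ wk c ⟧ (q ∷ ρ)
    to : ∀ {ρ} → Quotient ρ × ⟦ r ⟧ ρ < suc (⟦ m ⟧ ρ) → ⟦ r ⟧ ρ ≡ ⟦ c ⟧ ρ % suc (⟦ m ⟧ ρ)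
    to {ρ} ((q , e) , lt) rewrite ⟦wk⟧ m q ρ | ⟦wk⟧ r q ρ | ⟦wk⟧ c q ρ =
      remainder-unique q (suc (⟦ m ⟧ ρ)) (⟦ r ⟧ ρ) (⟦ c ⟧ ρ) e lt
    from : ∀ {ρ} → ⟦ r ⟧ ρ ≡ ⟦ c ⟧ ρ % suc (⟦ m ⟧ ρ) → Quotient ρ × ⟦ r ⟧ ρ < suc (⟦ m ⟧ ρ)
    from {ρ} e = (C / M , division) , subst (_< M) (sym e) (m%n<n C M)
      where
      C M : ℕ
      C = ⟦ c ⟧ ρ
      M = suc (⟦ m ⟧ ρ)
      division : (C / M) * ⟦ wk (tsuc m) ⟧ (C / M ∷ ρ) + ⟦ wk r ⟧ (C / M ∷ ρ) ≡ ⟦ wk c ⟧ (C / M ∷ ρ)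
      division rewrite ⟦wk⟧ m (C / M) ρ | ⟦wk⟧ r (C / M) ρ | ⟦wk⟧ c (C / M) ρ | e =
        trans (+-comm ((C / M) * M) (C % M)) (sym (m≡m%n+[m/n]*n C M))

  IsBeta-defines : ∀ {k} (c d i r : Term k) →
                   Defines S (IsBeta c d i r) (λ ρ → ⟦ r ⟧ ρ ≡ β (⟦ c ⟧ ρ) (⟦ d ⟧ ρ) (⟦ i ⟧ ρ))
  IsBeta-defines c d i r = IsRem-defines c (ttimes (tsuc i) d) r

  IsPair-defines : ∀ {k} (a b y : Term k) →
                   Defines S (IsPair a b y) (λ ρ → ⟦ y ⟧ ρ ≡ pair (⟦ a ⟧ ρ) (⟦ b ⟧ ρ))
  IsPair-defines a b y = ⇔-defines to from (≐-defines _ _)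
    where
    to : ∀ {ρ} → 2 * ⟦ y ⟧ ρ ≡ _ → ⟦ y ⟧ ρ ≡ pair (⟦ a ⟧ ρ) (⟦ b ⟧ ρ)
    to {ρ} e = *-cancelˡ-≡ (⟦ y ⟧ ρ) _ 2 (trans e (sym (2*pair (⟦ a ⟧ ρ) (⟦ b ⟧ ρ))))
    from : ∀ {ρ} → ⟦ y ⟧ ρ ≡ pair (⟦ a ⟧ ρ) (⟦ b ⟧ ρ) → 2 * ⟦ y ⟧ ρ ≡ _
    from {ρ} e = trans (cong (2 *_) e) (2*pair (⟦ a ⟧ ρ) (⟦ b ⟧ ρ))

  ∀<-defines : ∀ {k} (t : Term k) {ψ : Formula (suc k)} {Q : Vec ℕ (suc k) → Set} →
               Defines S ψ Q → (∀ ρ → Dec (Q ρ)) →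
               Defines S (∀' (Less v₀ (wk t) ⇒' ψ)) (λ ρ → ∀ i → i < ⟦ t ⟧ ρ → Q (i ∷ ρ))
  ∀<-defines t {ψ} {Q} dψ Q? = record { sound = sound′ ; complete = complete′ ; refute = refute′ }
    where
    less : Defines S (Less v₀ (wk t)) (λ ρ → lookup ρ fz < ⟦ wk t ⟧ ρ)
    less = Less-defines v₀ (wk t)

    sound′ : ∀ ρ → Tr S (∀' (Less v₀ (wk t) ⇒' ψ)) ρ → ∀ i → i < ⟦ t ⟧ ρ → Q (i ∷ ρ)
    sound′ ρ h i i<t with h i
    ... | inj₁ f = contradiction (subst (i <_) (sym (⟦wk⟧ t i ρ)) i<t) (defines-refuted _ less (i ∷ ρ) f)
    ... | inj₂ q = sound dψ (i ∷ ρ) q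

    complete′ : ∀ ρ → (∀ i → i < ⟦ t ⟧ ρ → Q (i ∷ ρ)) → Tr S (∀' (Less v₀ (wk t) ⇒' ψ)) ρ
    complete′ ρ h i with i <? ⟦ t ⟧ ρ
    ... | yes i<t = inj₂ (complete dψ (i ∷ ρ) (h i i<t))
    ... | no  i≮t = inj₁ (refute less (i ∷ ρ) (i≮t ∘ subst (i <_) (⟦wk⟧ t i ρ)))

    refute′ : ∀ ρ → ¬ (∀ i → i < ⟦ t ⟧ ρ → Q (i ∷ ρ)) → Fa S (∀' (Less v₀ (wk t) ⇒' ψ)) ρ
    refute′ ρ ¬h with anyUpTo? (λ i → ¬? (Q? (i ∷ ρ))) (⟦ t ⟧ ρ)
    ... | yes (i , i<t , ¬q) =
      i , complete less (i ∷ ρ) (subst (i <_) (sym (⟦wk⟧ t i ρ)) i<t) , refute dψ (i ∷ ρ) ¬q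
    ... | no ¬∃ = ⊥-elim (¬h (λ i i<t → decidable-stable (Q? (i ∷ ρ)) (λ ¬q → ¬∃ (i , i<t , ¬q))))


  private
    StepHolds : ∀ {k} → Vec ℕ (suc (suc (suc k))) → Set
    StepHolds (i ∷ d ∷ c ∷ _) = β c d (suc i) ≡ pair 2 (β c d i)

    StepHolds? : ∀ {k} (ρ : Vec ℕ (suc (suc (suc k)))) → Dec (StepHolds ρ)
    StepHolds? (i ∷ d ∷ c ∷ _) = β c d (suc i) ≟ pair 2 (β c d i)

    NumCodeStep-defines : ∀ {k} → Defines S (NumCodeStep {k}) StepHolds
    NumCodeStep-defines = ⇔-defines to from
      (∃-defines (∃-defines
        (∧-defines (IsBeta-defines v₄ v₃ v₂ v₁)
          (∧-defines (IsBeta-defines v₄ v₃ (tsuc v₂) v₀) (IsPair-defines (num 2) v₁ v₀)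
            (λ _ → ¬×-splitˡ (_ ≟ _)))
          (λ _ → ¬×-splitˡ (_ ≟ _)))))
      where
      to : ∀ {ρ} → (∃ λ r → ∃ λ r′ → r ≡ _ × r′ ≡ _ × r′ ≡ pair 2 r) → StepHolds ρ
      to {_ ∷ _ ∷ _ ∷ _} (_ , _ , refl , refl , e) = e
      from : ∀ {ρ} → StepHolds ρ → ∃ λ r → ∃ λ r′ → r ≡ _ × r′ ≡ _ × r′ ≡ pair 2 r
      from {i ∷ d ∷ c ∷ _} e = β c d i , β c d (suc i) , refl , refl , e

  IsNumCode-defines : ∀ {k} (z w : Term k) →
                      Defines S (IsNumCode z w) (λ ρ → ⟦ w ⟧ ρ ≡ numCode (⟦ z ⟧ ρ))
  IsNumCode-defines {k} z w = ⇔-defines to from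
    (∃-defines (∃-defines
      (∧-defines (IsBeta-defines v₁ v₀ (num 0) (num 1))
        (∧-defines (IsBeta-defines v₁ v₀ (wk² z) (wk² w)) (∀<-defines (wk² z) NumCodeStep-defines StepHolds?)
          (λ _ → ¬×-splitˡ (_ ≟ _)))
        (λ _ → ¬×-splitˡ (_ ≟ _)))))
    where
    Trace : Vec ℕ k → Set
    Trace ρ = ∃ λ c → ∃ λ d → 1 ≡ β c d 0 × (⟦ wk² w ⟧ (d ∷ c ∷ ρ) ≡ β c d (⟦ wk² z ⟧ (d ∷ c ∷ ρ)) ×
              (∀ i → i < ⟦ wk² z ⟧ (d ∷ c ∷ ρ) → β c d (suc i) ≡ pair 2 (β c d i)))
    to : ∀ {ρ} → Trace ρ → ⟦ w ⟧ ρ ≡ numCode (⟦ z ⟧ ρ)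
    to {ρ} (c , d , β₀ , βz , βsuc) = begin
      ⟦ w ⟧ ρ                         ≡⟨ ⟦wk²⟧ w d c ρ ⟨
      ⟦ wk² w ⟧ (d ∷ c ∷ ρ)           ≡⟨ trace⇒numCode {c} {d}
                                           (record { β-zero = β₀ ; β-last = βz ; β-step = βsuc }) ⟩
      numCode (⟦ wk² z ⟧ (d ∷ c ∷ ρ)) ≡⟨ cong numCode (⟦wk²⟧ z d c ρ) ⟩
      numCode (⟦ z ⟧ ρ)               ∎
      where open ≡-Reasoning
    from : ∀ {ρ} → ⟦ w ⟧ ρ ≡ numCode (⟦ z ⟧ ρ) → Trace ρ
    from {ρ} e with numCode-trace (⟦ z ⟧ ρ)
    ... | c , d , trace rewrite sym (⟦wk²⟧ z d c ρ) | sym e | sym (⟦wk²⟧ w d c ρ) =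
      c , d , β-zero , β-last , β-step
      where open NumCodeTrace trace

  IsPairExprVia-defines : ∀ {k k′} (f : Term k → Term k′) (g : Vec ℕ k′ → Vec ℕ k) →
                          (∀ t ρ → ⟦ f t ⟧ ρ ≡ ⟦ t ⟧ (g ρ)) → ∀ e y →
                          Defines S (IsPairExprVia f e y) (λ ρ → ⟦ y ⟧ ρ ≡ ⟦ e ⟧ᴾ (g ρ))
  IsPairExprVia-defines f g fg (leaf t) y =
    ⇔-defines (λ {ρ} e → trans e (fg t ρ)) (λ {ρ} e → trans e (sym (fg t ρ))) (≐-defines y (f t))
  IsPairExprVia-defines {k} {k′} f g fg (node a b) y = ⇔-defines to from
    (∃-defines (∃-defines
      (∧-defines (IsPairExprVia-defines (wk² ∘ f) g₂ fg₂ a v₁)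
        (∧-defines (IsPairExprVia-defines (wk² ∘ f) g₂ fg₂ b v₀) (IsPair-defines v₁ v₀ (wk² y))
          (λ _ → ¬×-splitˡ (_ ≟ _)))
        (λ _ → ¬×-splitˡ (_ ≟ _)))))
    where
    g₂ : Vec ℕ (suc (suc k′)) → Vec ℕ k
    g₂ (_ ∷ _ ∷ ρ) = g ρ
    fg₂ : ∀ t ρ → ⟦ wk² (f t) ⟧ ρ ≡ ⟦ t ⟧ (g₂ ρ)
    fg₂ t (m₀ ∷ m₁ ∷ ρ) = trans (⟦wk²⟧ (f t) m₀ m₁ ρ) (fg t ρ)
    Parts : Vec ℕ k′ → Set
    Parts ρ = ∃ λ m₁ → ∃ λ m₀ → m₁ ≡ ⟦ a ⟧ᴾ (g ρ) × m₀ ≡ ⟦ b ⟧ᴾ (g ρ) ×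
                                 ⟦ wk² y ⟧ (m₀ ∷ m₁ ∷ ρ) ≡ pair m₁ m₀
    to : ∀ {ρ} → Parts ρ → ⟦ y ⟧ ρ ≡ pairᵒ (⟦ a ⟧ᴾ (g ρ)) (⟦ b ⟧ᴾ (g ρ))
    to {ρ} (m₁ , m₀ , refl , refl , e) =
      trans (sym (⟦wk²⟧ y m₀ m₁ ρ)) (trans e (sym (pairᵒ≡pair m₁ m₀)))
    from : ∀ {ρ} → ⟦ y ⟧ ρ ≡ pairᵒ (⟦ a ⟧ᴾ (g ρ)) (⟦ b ⟧ᴾ (g ρ)) → Parts ρ
    from {ρ} e = _ , _ , refl , refl , trans (⟦wk²⟧ y _ _ ρ) (trans e (pairᵒ≡pair _ _))

  IsPairExpr-defines : ∀ {k} (e : PairExpr k) y → Defines S (IsPairExpr e y) (λ ρ → ⟦ y ⟧ ρ ≡ ⟦ e ⟧ᴾ ρ)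
  IsPairExpr-defines = IsPairExprVia-defines id id (λ _ _ → refl)

  opaque
    unfolding IsσCode

    IsσCode-defines : ∀ {k} (a j y : Term k) →
                      Defines S (IsσCode a j y) (λ ρ → ⟦ y ⟧ ρ ≡ σCode (⟦ a ⟧ ρ) (⟦ j ⟧ ρ))
    IsσCode-defines {k} a j y = ⇔-defines to from
      (∃-defines (∃-defines
        (∧-defines (IsNumCode-defines (wk² a) v₁)
          (∧-defines (IsNumCode-defines (wk² j) v₀)
            (IsPairExpr-defines (diagCodeᴾ (leaf (wk² a)) (leaf v₁) (leaf v₀)) (wk² y))
            (λ _ → ¬×-splitˡ (_ ≟ _)))
          (λ _ → ¬×-splitˡ (_ ≟ _)))))
      where
      Parts : Vec ℕ k → Set
      Parts ρ = ∃ λ w → ∃ λ w′ → w ≡ numCode (⟦ wk² a ⟧ (w′ ∷ w ∷ ρ)) ×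
                                 w′ ≡ numCode (⟦ wk² j ⟧ (w′ ∷ w ∷ ρ)) ×
                                 ⟦ wk² y ⟧ (w′ ∷ w ∷ ρ) ≡ diagCode (⟦ wk² a ⟧ (w′ ∷ w ∷ ρ)) w w′
      to : ∀ {ρ} → Parts ρ → ⟦ y ⟧ ρ ≡ σCode (⟦ a ⟧ ρ) (⟦ j ⟧ ρ)
      to {ρ} (w , w′ , ew , ew′ , ey) = begin
        ⟦ y ⟧ ρ                                            ≡⟨ ⟦wk²⟧ y w′ w ρ ⟨
        ⟦ wk² y ⟧ (w′ ∷ w ∷ ρ)                              ≡⟨ ey ⟩
        diagCode (⟦ wk² a ⟧ (w′ ∷ w ∷ ρ)) w w′              ≡⟨ cong₂ (λ h i → diagCode h i w′) ⟦a⟧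
                                                                 (trans ew (cong numCode ⟦a⟧)) ⟩
        diagCode (⟦ a ⟧ ρ) (numCode (⟦ a ⟧ ρ)) w′           ≡⟨ cong (diagCode (⟦ a ⟧ ρ) (numCode (⟦ a ⟧ ρ)))
                                                                 (trans ew′ (cong numCode (⟦wk²⟧ j w′ w ρ))) ⟩
        σCode (⟦ a ⟧ ρ) (⟦ j ⟧ ρ)                           ∎
        where
        open ≡-Reasoning
        ⟦a⟧ : ⟦ wk² a ⟧ (w′ ∷ w ∷ ρ) ≡ ⟦ a ⟧ ρ
        ⟦a⟧ = ⟦wk²⟧ a w′ w ρ
      from : ∀ {ρ} → ⟦ y ⟧ ρ ≡ σCode (⟦ a ⟧ ρ) (⟦ j ⟧ ρ) → Parts ρ
      from {ρ} e =
        w , w′ , cong numCode (sym ⟦a⟧) , cong numCode (sym (⟦wk²⟧ j w′ w ρ)) ,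
        trans (⟦wk²⟧ y w′ w ρ) (trans e (cong (λ h → diagCode h w w′) (sym ⟦a⟧)))
        where
        w w′ : ℕ
        w = numCode (⟦ a ⟧ ρ)
        w′ = numCode (⟦ j ⟧ ρ)
        ⟦a⟧ : ⟦ wk² a ⟧ (w′ ∷ w ∷ ρ) ≡ ⟦ a ⟧ ρ
        ⟦a⟧ = ⟦wk²⟧ a w′ w ρ

module _ {S : ℕ → Set} (H : Formula 2) (a i : ℕ) where

  Tr-diag⁺ : Tr S H (i ∷ a ∷ []) → TrueIn S (diag H a i)
  Tr-diag⁺ h = a , sym (⟦num⟧ a (a ∷ [])) , i , sym (⟦num⟧ i (i ∷ a ∷ [])) , h

  Tr-diag⁻ : TrueIn S (diag H a i) → Tr S H (i ∷ a ∷ [])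
  Tr-diag⁻ (m , m≡a , m′ , m′≡i , h) =
    subst₂ (λ u v → Tr S H (u ∷ v ∷ []))
           (trans m′≡i (⟦num⟧ i (m′ ∷ m ∷ []))) (trans m≡a (⟦num⟧ a (m ∷ []))) h

  Fa-diag⁺ : Fa S H (i ∷ a ∷ []) → FalseIn S (diag H a i)
  Fa-diag⁺ h m with m ≟ a
  ... | no m≢a   = inj₁ (λ e → m≢a (trans e (⟦num⟧ a (m ∷ []))))
  ... | yes refl = inj₂ λ m′ → inner m′ (m′ ≟ i)
    where
    inner : ∀ m′ → Dec (m′ ≡ i) → Fa S ((v₀ ≐ num i) ∧' H) (m′ ∷ a ∷ [])
    inner m′ (no m′≢i) = inj₁ (λ e → m′≢i (trans e (⟦num⟧ i (m′ ∷ a ∷ []))))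
    inner m′ (yes refl) = inj₂ h

  Fa-diag⁻ : FalseIn S (diag H a i) → Fa S H (i ∷ a ∷ [])
  Fa-diag⁻ f with f a
  ... | inj₁ a≢a = ⊥-elim (a≢a (sym (⟦num⟧ a (a ∷ []))))
  ... | inj₂ g with g i
  ...   | inj₁ i≢i = ⊥-elim (i≢i (sym (⟦num⟧ i (i ∷ a ∷ []))))
  ...   | inj₂ h   = h

diag-index : Sentence → Term 2
diag-index (¬' (∀' (¬' (_ ∧' (¬' (∀' (¬' ((_ ≐ t) ∧' _)))))))) = t
diag-index _                                                   = tzero

diag-injective : ∀ H a {i j} → diag H a i ≡ diag H a j → i ≡ j
diag-injective H a e = num-injective (cong diag-index e)

-- In the context (i , a), Hσ says: either i = 0 and the sentence
-- with code σCode a 0 is not true, or i ≠ 0, the sentence with code σCode a i is true and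
-- those with code σCode a q, for q ∉ {0, i}, are not true.  As σCode ⌜Hσ⌝ q = ⌜ σ q ⌝,
-- σ 0 is a liar sentence and σ (1 + p) says that it is the only true one among σ 1, σ 2, …
NotTrueσ : ∀ {k} → Term (suc k) → Term (suc k) → Formula (suc k)
NotTrueσ a q = ∃' (IsσCode (wk a) (wk q) v₀ ∧' (¬' (True v₀)))

SelfTrueσ : Formula 2
SelfTrueσ = ∃' (IsσCode v₂ v₁ v₀ ∧' True v₀)

OthersNotTrueσ : Formula 2
OthersNotTrueσ = ∀' (((¬' (v₀ ≐ tzero)) ∧' (¬' (v₀ ≐ v₁))) ⇒' NotTrueσ v₂ v₀)

Hσ : Formula 2
Hσ = ((v₀ ≐ tzero) ∧' NotTrueσ v₁ tzero) ∨' ((¬' (v₀ ≐ tzero)) ∧' (SelfTrueσ ∧' OthersNotTrueσ))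

⌜Hσ⌝ : ℕ
⌜Hσ⌝ = codeᵒ Hσ

⌜Hσ⌝≡ : ⌜Hσ⌝ ≡ code Hσ
⌜Hσ⌝≡ = codeᵒ≡code Hσ

-- σ is opaque for the same reason as codeᵒ.
opaque
  σ : ℕ → Sentence
  σ = diag Hσ ⌜Hσ⌝

  σ-unfold : ∀ i → σ i ≡ diag Hσ ⌜Hσ⌝ i
  σ-unfold i = refl

σ-code : ∀ i → ⌜ σ i ⌝ ≡ σCode ⌜Hσ⌝ i
σ-code i = trans (cong code (σ-unfold i))
             (trans (diag-code Hσ ⌜Hσ⌝ i) (cong (λ h → diagCode h (numCode ⌜Hσ⌝) (numCode i)) (sym ⌜Hσ⌝≡)))

σ-injective : ∀ {i j} → σ i ≡ σ j → i ≡ j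
σ-injective {i} {j} e = diag-injective Hσ ⌜Hσ⌝ (trans (sym (σ-unfold i)) (trans e (σ-unfold j)))

σ≢¬σ : ∀ i j → σ i ≢ ¬' σ j
σ≢¬σ i j e with trans (sym (σ-unfold i)) (trans e (cong ¬'_ (σ-unfold j)))
... | ()

σ≢¬¬σ : ∀ i j → σ i ≢ ¬' (¬' σ j)
σ≢¬¬σ i j e with trans (sym (σ-unfold i)) e
... | ()

module _ {S : ℕ → Set} (i : ℕ) where

  Tr-σ⁺ : Tr S Hσ (i ∷ ⌜Hσ⌝ ∷ []) → TrueIn S (σ i)
  Tr-σ⁺ = subst (λ φ → TrueIn S φ) (sym (σ-unfold i)) ∘ Tr-diag⁺ Hσ ⌜Hσ⌝ i

  Tr-σ⁻ : TrueIn S (σ i) → Tr S Hσ (i ∷ ⌜Hσ⌝ ∷ [])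
  Tr-σ⁻ = Tr-diag⁻ Hσ ⌜Hσ⌝ i ∘ subst (λ φ → TrueIn S φ) (σ-unfold i)

  Fa-σ⁺ : Fa S Hσ (i ∷ ⌜Hσ⌝ ∷ []) → FalseIn S (σ i)
  Fa-σ⁺ = subst (λ φ → FalseIn S φ) (sym (σ-unfold i)) ∘ Fa-diag⁺ Hσ ⌜Hσ⌝ i

  Fa-σ⁻ : FalseIn S (σ i) → Fa S Hσ (i ∷ ⌜Hσ⌝ ∷ [])
  Fa-σ⁻ = Fa-diag⁻ Hσ ⌜Hσ⌝ i ∘ subst (λ φ → FalseIn S φ) (σ-unfold i)

module _ (w : FIX) where
  private
    Sw : ℕ → Set
    Sw = proj₁ w
    open Definability Sw
    open Defines

  σ₀-not-true : ¬ TrueIn Sw (σ 0)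
  σ₀-not-true t with Tr-σ⁻ 0 t
  ... | inj₂ (0≢0 , _)          = 0≢0 refl
  ... | inj₁ (_ , y , y≡ , not) =
    ¬true×false w (σ 0) t (false-via-True w (σ 0) (trans y-is-code (sym (σ-code 0))) not)
    where
    y-is-code : y ≡ σCode ⌜Hσ⌝ 0
    y-is-code = sound (IsσCode-defines (wk v₁) (wk tzero) v₀) (y ∷ 0 ∷ ⌜Hσ⌝ ∷ []) y≡

  σ₀-not-false : ¬ FalseIn Sw (σ 0)
  σ₀-not-false f with proj₁ (Fa-σ⁻ 0 f)
  ... | inj₁ 0≢0 = 0≢0 refl
  ... | inj₂ g with g (σCode ⌜Hσ⌝ 0)
  ...   | inj₁ no-code =
    defines-refuted (IsσCode-TrueFree (wk v₁) (wk tzero) v₀) (IsσCode-defines (wk v₁) (wk tzero) v₀)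
                    (σCode ⌜Hσ⌝ 0 ∷ 0 ∷ ⌜Hσ⌝ ∷ []) no-code refl
  ...   | inj₂ s       = ¬true×false w (σ 0) (∈⇒true w (σ 0) (subst Sw (sym (σ-code 0)) s)) f

  σ-unique-true : ∀ p → TrueIn Sw (σ (suc p)) → ∀ q → q ≢ p → FalseIn Sw (σ (suc q))
  σ-unique-true p t q q≢p with Tr-σ⁻ (suc p) t
  ... | inj₁ (() , _)
  ... | inj₂ (_ , _ , others) with others (suc q)
  ...   | inj₁ (inj₁ ())
  ...   | inj₁ (inj₂ 1+q≡1+p) = ⊥-elim (q≢p (suc-injective 1+q≡1+p))
  ...   | inj₂ (y , y≡ , not) = false-via-True w (σ (suc q)) (trans y-is-code (sym (σ-code (suc q)))) not
    where
    y-is-code : y ≡ σCode ⌜Hσ⌝ (suc q)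
    y-is-code = sound (IsσCode-defines (wk v₂) (wk v₀) v₀) (y ∷ suc q ∷ suc p ∷ ⌜Hσ⌝ ∷ []) y≡

module Select (p : ℕ) where
  S₀ : ℕ → Set
  S₀ n = n ≡ ⌜ σ (suc p) ⌝ ⊎ ∃ λ q → q ≢ p × n ≡ ⌜ ¬' σ (suc q) ⌝

  private
    open Definability S₀
    open Defines

    S₀-sentences : ∀ n → S₀ n → IsSentCode n
    S₀-sentences n (inj₁ e)           = σ (suc p) , sym e
    S₀-sentences n (inj₂ (q , _ , e)) = ¬' σ (suc q) , sym e

    ¬σ∈S₀ : ∀ q → q ≢ p → S₀ ⌜ ¬' σ (suc q) ⌝
    ¬σ∈S₀ q q≢p = inj₂ (q , q≢p , refl)

    σ-true : TrueIn S₀ (σ (suc p))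
    σ-true = Tr-σ⁺ (suc p) (inj₂ ((λ ()) , self , others))
      where
      self : Tr S₀ SelfTrueσ (suc p ∷ ⌜Hσ⌝ ∷ [])
      self = ⌜ σ (suc p) ⌝ ,
             complete (IsσCode-defines v₂ v₁ v₀) (⌜ σ (suc p) ⌝ ∷ suc p ∷ ⌜Hσ⌝ ∷ []) (σ-code (suc p)) ,
             inj₁ refl
      others : Tr S₀ OthersNotTrueσ (suc p ∷ ⌜Hσ⌝ ∷ [])
      others zero    = inj₁ (inj₁ refl)
      others (suc q) with q ≟ p
      ... | yes q≡p = inj₁ (inj₂ (cong suc q≡p))
      ... | no  q≢p = inj₂ (⌜ σ (suc q) ⌝ ,
                            complete (IsσCode-defines (wk v₂) (wk v₀) v₀)
                              (⌜ σ (suc q) ⌝ ∷ suc q ∷ suc p ∷ ⌜Hσ⌝ ∷ []) (σ-code (suc q)) ,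
                            inj₂ (σ (suc q) , refl , ¬σ∈S₀ q q≢p))

    σ-false : ∀ q → q ≢ p → FalseIn S₀ (σ (suc q))
    σ-false q q≢p = Fa-σ⁺ (suc q) (inj₁ (λ ()) , inj₂ (inj₁ not-self))
      where
      not-self : Fa S₀ SelfTrueσ (suc q ∷ ⌜Hσ⌝ ∷ [])
      not-self y with y ≟ ⌜ σ (suc q) ⌝
      ... | yes y≡ = inj₂ (inj₂ (σ (suc q) , sym y≡ , ¬σ∈S₀ q q≢p))
      ... | no  y≢ = inj₁ (refute (IsσCode-defines v₂ v₁ v₀) (y ∷ suc q ∷ ⌜Hσ⌝ ∷ [])
                                  (λ e → y≢ (trans e (sym (σ-code (suc q))))))

    S₀-sound : ∀ φ → S₀ ⌜ φ ⌝ → TrueIn S₀ φ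
    S₀-sound φ (inj₁ e) with code-injective {φ = φ} {σ (suc p)} e
    ... | refl = σ-true
    S₀-sound φ (inj₂ (q , q≢p , e)) with code-injective {φ = φ} {¬' σ (suc q)} e
    ... | refl = σ-false q q≢p

    S₀-consistent : ∀ φ → S₀ ⌜ φ ⌝ → S₀ ⌜ ¬' φ ⌝ → ⊥
    S₀-consistent φ s (inj₁ e) with code-injective {φ = ¬' φ} {σ (suc p)} e
    ... | ¬φ≡σ with s
    ...   | inj₁ e′ with code-injective {φ = φ} {σ (suc p)} e′
    ...     | refl = σ≢¬σ (suc p) (suc p) (sym ¬φ≡σ)
    S₀-consistent φ s (inj₁ e) | ¬φ≡σ | inj₂ (q , _ , e′) with code-injective {φ = φ} {¬' σ (suc q)} e′
    ...     | refl = σ≢¬¬σ (suc p) (suc q) (sym ¬φ≡σ)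
    S₀-consistent φ s (inj₂ (q , q≢p , e)) with code-injective {φ = ¬' φ} {¬' σ (suc q)} e
    S₀-consistent φ (inj₁ e′) (inj₂ (q , q≢p , _)) | refl =
      q≢p (suc-injective (σ-injective (code-injective {φ = σ (suc q)} {σ (suc p)} e′)))
    S₀-consistent φ (inj₂ (q′ , _ , e′)) (inj₂ (q , _ , _)) | refl =
      σ≢¬σ (suc q) (suc q′) (code-injective {φ = σ (suc q)} {¬' σ (suc q′)} e′)

    module C = Closure S₀ S₀-sentences S₀-sound S₀-consistent

  selecting : FIX
  selecting = C.fixpoint

  selected-true : TrueIn (proj₁ selecting) (σ (suc p))
  selected-true = C.seed-true (σ (suc p)) (inj₁ refl)

  others-false : ∀ q → q ≢ p → FalseIn (proj₁ selecting) (σ (suc q))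
  others-false q q≢p = C.seed-true (¬' σ (suc q)) (¬σ∈S₀ q q≢p)

any-vec? : ∀ {k} n {P : Vec (Fin k) n → Set} → (∀ v → Dec (P v)) → Dec (∃ P)
any-vec? zero    P? = map′ ([] ,_) (λ { ([] , p) → p }) (P? [])
any-vec? (suc n) P? = map′ (λ (c , v , p) → c ∷ v , p) (λ { (c ∷ v , p) → c , v , p })
                           (Finₚ.any? λ c → any-vec? n (P? ∘ (c ∷_)))

all-vec? : ∀ {k} n {P : Vec (Fin k) n → Set} → (∀ v → Dec (P v)) → Dec (∀ v → P v)
all-vec? zero    P? = map′ (λ { p [] → p }) (λ h → h []) (P? [])
all-vec? (suc n) P? = map′ (λ h → λ { (c ∷ v) → h c v }) (λ h c v → h (c ∷ v))
                           (Finₚ.all? λ c → all-vec? n (P? ∘ (c ∷_)))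

infix 4 _⊑_ _⊑?_

_⊑_ : Fin 3 → Fin 3 → Set
c ⊑ d = c ≡ three ⊎ c ≡ d

_⊑?_ : ∀ c d → Dec (c ⊑ d)
c ⊑? d = (c Finₚ.≟ three) ⊎-dec (c Finₚ.≟ d)

⊑-three : ∀ {c} → c ⊑ three → c ≡ three
⊑-three (inj₁ c≡three) = c≡three
⊑-three (inj₂ c≡three) = c≡three

Least : ∀ {n} → (Vec (Fin 3) n → Bool) → Vec (Fin 3) n → Set
Least S c = S c ≡ true × (∀ a → S a ≡ true → ∀ j → lookup c j ⊑ lookup a j)

least? : ∀ {n} (S : Vec (Fin 3) n → Bool) c → Dec (Least S c)
least? {n} S c = (S c Boolₚ.≟ true) ×-dec
  all-vec? n (λ a → (S a Boolₚ.≟ true) →-dec Finₚ.all? (λ j → lookup c j ⊑? lookup a j))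

least⇒primeConditions : ∀ {n} {S : Vec (Fin 3) n → Bool} {c} → Least S c → PrimeConditions S
least⇒primeConditions {c = c} (Sc , c⊑) = record
  { nonempty = c , Sc
  ; slice    = λ j (a , Sa , aj≡1) (b , Sb , bj≡2) → c , Sc , neither-at j Sa Sb aj≡1 bj≡2
  ; neither  = λ t _ s h → c , Sc , λ i →
                 let (a , Sa , a≡3) = h i in ⊑-three (subst (lookup c (s i) ⊑_) a≡3 (c⊑ a Sa (s i)))
  }
  where
  neither-at : ∀ j {a b} → _ → _ → lookup a j ≡ one → lookup b j ≡ two → lookup c j ≡ three
  neither-at j {a} {b} Sa Sb aj≡1 bj≡2 with c⊑ a Sa j | c⊑ b Sb j
  ... | inj₁ c≡3 | _        = c≡3
  ... | inj₂ _   | inj₁ c≡3 = c≡3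
  ... | inj₂ c≡a | inj₂ c≡b with trans (sym (trans c≡a aj≡1)) (trans c≡b bj≡2)
  ...   | ()

module _ {n} {S : Vec (Fin 3) n → Bool} (pc : PrimeConditions S) where
  open PrimeConditions pc

  private
    NeitherSomewhere : Fin n → Set
    NeitherSomewhere j = ∃ λ a → S a ≡ true × lookup a j ≡ three

    neitherSomewhere? : ∀ j → Dec (NeitherSomewhere j)
    neitherSomewhere? j = any-vec? n (λ a → (S a Boolₚ.≟ true) ×-dec (lookup a j Finₚ.≟ three))

    agree : ∀ j → ¬ NeitherSomewhere j → ∀ {a b} → S a ≡ true → S b ≡ true → lookup a j ≡ lookup b j
    agree j none {a} {b} Sa Sb with lookup a j in ea | lookup b j in eb
    ... | fz           | fz           = refl
    ... | fs fz        | fs fz        = refl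
    ... | fs (fs fz)   | _            = ⊥-elim (none (a , Sa , ea))
    ... | fz           | fs (fs fz)   = ⊥-elim (none (b , Sb , eb))
    ... | fs fz        | fs (fs fz)   = ⊥-elim (none (b , Sb , eb))
    ... | fz           | fs fz        = ⊥-elim (none (slice j (a , Sa , ea) (b , Sb , eb)))
    ... | fs fz        | fz           = ⊥-elim (none (slice j (b , Sb , eb) (a , Sa , ea)))

    neither-wherever-possible : ∃ λ c → S c ≡ true × (∀ j → NeitherSomewhere j → lookup c j ≡ three)
    neither-wherever-possible with Finₚ.any? neitherSomewhere?
    ... | no none =
      let (c , Sc) = nonempty in c , Sc , λ j ns → ⊥-elim (none (j , ns))
    ... | yes (j₀ , ns₀) =
      let (c , Sc , c≡3) = neither n ≤-refl (proj₁ ∘ pick) (proj₂ ∘ pick)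
      in c , Sc , λ j ns → subst (λ i → lookup c i ≡ three) (pick-fixes j ns) (c≡3 j)
      where
      -- The neither condition is applied to all coordinates, with j₀ standing in for
      -- those where no member of S is neither.
      pick : Fin n → Σ (Fin n) NeitherSomewhere
      pick i with neitherSomewhere? i
      ... | yes ns = i , ns
      ... | no _   = j₀ , ns₀
      pick-fixes : ∀ j → NeitherSomewhere j → proj₁ (pick j) ≡ j
      pick-fixes j ns with neitherSomewhere? j
      ... | yes _   = refl
      ... | no  ¬ns = ⊥-elim (¬ns ns)

  primeConditions⇒least : ∃ (Least S)
  primeConditions⇒least =
    let (c , Sc , c≡3) = neither-wherever-possible in c , Sc , λ a Sa j → below c Sc c≡3 a Sa j
    where
    below : ∀ c → S c ≡ true → (∀ j → NeitherSomewhere j → lookup c j ≡ three) →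
            ∀ a → S a ≡ true → ∀ j → lookup c j ⊑ lookup a j
    below c Sc c≡3 a Sa j with neitherSomewhere? j
    ... | yes ns   = inj₁ (c≡3 j ns)
    ... | no  none = inj₂ (agree j none Sc Sa)

Realizes : ∀ {n} → FIX → (Fin n → Sentence) → Vec (Fin 3) n → Set
Realizes w Y a = ∀ i → HasValue w (Y i) (lookup a i)

Realizes-unique : ∀ {n} w (Y : Fin n → Sentence) a b → Realizes w Y a → Realizes w Y b → a ≡ b
Realizes-unique w Y a b ra rb = begin
  a                    ≡⟨ tabulate∘lookup a ⟨
  tabulate (lookup a)  ≡⟨ tabulate-cong (λ i → HasValue-unique w (Y i) (ra i) (rb i)) ⟩
  tabulate (lookup b)  ≡⟨ tabulate∘lookup b ⟩
  b                    ∎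
  where open ≡-Reasoning

¬¬-∀-Fin : ∀ {n} {P : Fin n → Set} → (∀ i → ¬ ¬ P i) → ¬ ¬ (∀ i → P i)
¬¬-∀-Fin {zero}      _  k = k (λ ())
¬¬-∀-Fin {suc n} {P} ¬¬P k =
  ¬¬P fz λ p₀ → ¬¬-∀-Fin (¬¬P ∘ fs) λ ps → k λ { fz → p₀ ; (fs i) → ps i }

¬¬Realizes : ∀ {n} w (Y : Fin n → Sentence) → ¬ ¬ ∃ (Realizes w Y)
¬¬Realizes w Y k = ¬¬-∀-Fin (λ i → ¬¬HasValue w (Y i)) λ vals →
  k (tabulate (proj₁ ∘ vals) , λ i →
       subst (HasValue w (Y i)) (sym (lookup∘tabulate (proj₁ ∘ vals) i)) (proj₂ (vals i)))

⊩χ⇒HasValue : ∀ w ⋆ c y → w ⊩[ ⋆ ] χ c y → HasValue w (⋆ y) c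
⊩χ⇒HasValue w ⋆ fz           y (lift t)   = t
⊩χ⇒HasValue w ⋆ (fs fz)      y (lift f)   = f
⊩χ⇒HasValue w ⋆ (fs (fs fz)) y (¬t , ¬f)  = ¬t ∘ lift , ¬f ∘ lift

HasValue⇒⊩χ : ∀ w ⋆ c y → HasValue w (⋆ y) c → w ⊩[ ⋆ ] χ c y
HasValue⇒⊩χ w ⋆ fz           y t          = lift t
HasValue⇒⊩χ w ⋆ (fs fz)      y f          = lift f
HasValue⇒⊩χ w ⋆ (fs (fs fz)) y (¬t , ¬f)  = ¬t ∘ lower , ¬f ∘ lower

module _ (w : FIX) (⋆ : Realization) where

  ⊩⋀⁻ : ∀ {k} (φ : Fin (suc k) → MForm) → w ⊩[ ⋆ ] ⋀ (tabulate φ) → ∀ i → w ⊩[ ⋆ ] φ i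
  ⊩⋀⁻ {zero}  φ h       fz     = h
  ⊩⋀⁻ {suc k} φ (h , _) fz     = h
  ⊩⋀⁻ {suc k} φ (_ , h) (fs i) = ⊩⋀⁻ (φ ∘ fs) h i

  ⊩⋀⁺ : ∀ {k} (φ : Fin (suc k) → MForm) → (∀ i → w ⊩[ ⋆ ] φ i) → w ⊩[ ⋆ ] ⋀ (tabulate φ)
  ⊩⋀⁺ {zero}  φ h = h fz
  ⊩⋀⁺ {suc k} φ h = h fz , ⊩⋀⁺ (φ ∘ fs) (h ∘ fs)

  ⊩ε⇒Realizes : ∀ {m} (x : Fin (suc m) → ℕ) a → w ⊩[ ⋆ ] ε x a → Realizes w (⋆ ∘ x) a
  ⊩ε⇒Realizes x a h i = ⊩χ⇒HasValue w ⋆ (lookup a i) (x i) (⊩⋀⁻ (λ i → χ (lookup a i) (x i)) h i)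

  Realizes⇒⊩ε : ∀ {m} (x : Fin (suc m) → ℕ) a → Realizes w (⋆ ∘ x) a → w ⊩[ ⋆ ] ε x a
  Realizes⇒⊩ε x a r = ⊩⋀⁺ (λ i → χ (lookup a i) (x i)) (λ i → HasValue⇒⊩χ w ⋆ (lookup a i) (x i) (r i))

-- Realization to least element

module LeastFixpoint = Closure (λ _ → ⊥) (λ _ ()) (λ _ ()) (λ _ ())

least-fixpoint : FIX
least-fixpoint = LeastFixpoint.fixpoint

HasValue-persists : ∀ v φ c → c ≢ three → HasValue least-fixpoint φ c → HasValue v φ c
HasValue-persists v φ fz           _   t = Tr-mono (LeastFixpoint.D⊆ v (λ ())) φ [] t
HasValue-persists v φ (fs fz)      _   f = Fa-mono (LeastFixpoint.D⊆ v (λ ())) φ [] f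
HasValue-persists v φ (fs (fs fz)) c≢3 _ = ⊥-elim (c≢3 refl)

least-realized : ∀ {n} (Y : Fin n → Sentence) c → Realizes least-fixpoint Y c →
                 ∀ v a → Realizes v Y a → ∀ j → lookup c j ⊑ lookup a j
least-realized Y c rc v a ra j with lookup c j Finₚ.≟ three
... | yes c≡3 = inj₁ c≡3
... | no  c≢3 = inj₂ (HasValue-unique v (Y j) (HasValue-persists v (Y j) _ c≢3 (rc j)) (ra j))

realizations⇒least : ∀ {n} (Y : Fin n → Sentence) (S : Vec (Fin 3) n → Bool) →
                     (∀ a → S a ≡ true → ¬ ¬ ∃ λ v → Realizes v Y a) →
                     (∀ v a → Realizes v Y a → S a ≡ true) →
                     ∃ (Least S)
realizations⇒least {n} Y S realizable realized∈S =
  decidable-stable (any-vec? n (least? S)) λ ¬least →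
    ¬¬Realizes least-fixpoint Y λ (c , rc) →
      ¬least (c , realized∈S least-fixpoint c rc , λ a Sa j →
        decidable-stable (lookup c j ⊑? lookup a j) λ ¬c⊑a →
          realizable a Sa λ (v , ra) → ¬c⊑a (least-realized Y c rc v a ra j))

-- Least element to realization

⊤ₛ ⊥ₛ : Sentence
⊤ₛ = tzero ≐ tzero
⊥ₛ = tzero ≐ tsuc tzero

⋁ᶠ : ∀ {k} → (Fin k → Sentence) → Sentence
⋁ᶠ {zero}  _ = ⊥ₛ
⋁ᶠ {suc k} φ = φ fz ∨' ⋁ᶠ (φ ∘ fs)

⋁ⱽ : ∀ {k} n → (Vec (Fin k) n → Sentence) → Sentence
⋁ⱽ zero    φ = φ []
⋁ⱽ (suc n) φ = ⋁ᶠ λ c → ⋁ⱽ n (φ ∘ (c ∷_))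

guarded : ∀ {P : Set} → Dec P → Sentence → Sentence
guarded (yes _) φ = φ
guarded (no _)  _ = ⊥ₛ

pick : Sentence → Sentence → Sentence → Sentence
pick φ ψ χ = φ ∨' ((¬' ψ) ∧' χ)

module _ {S : ℕ → Set} where

  ⋁ᶠ-true⁻ : ∀ {k} (φ : Fin k → Sentence) → TrueIn S (⋁ᶠ φ) → ∃ λ i → TrueIn S (φ i)
  ⋁ᶠ-true⁻ {suc k} φ (inj₁ t) = fz , t
  ⋁ᶠ-true⁻ {suc k} φ (inj₂ t) = let (i , t′) = ⋁ᶠ-true⁻ (φ ∘ fs) t in fs i , t′

  ⋁ᶠ-true⁺ : ∀ {k} (φ : Fin k → Sentence) i → TrueIn S (φ i) → TrueIn S (⋁ᶠ φ)
  ⋁ᶠ-true⁺ φ fz     t = inj₁ t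
  ⋁ᶠ-true⁺ φ (fs i) t = inj₂ (⋁ᶠ-true⁺ (φ ∘ fs) i t)

  ⋁ᶠ-false⁺ : ∀ {k} (φ : Fin k → Sentence) → (∀ i → FalseIn S (φ i)) → FalseIn S (⋁ᶠ φ)
  ⋁ᶠ-false⁺ {zero}  φ _ = λ ()
  ⋁ᶠ-false⁺ {suc k} φ f = f fz , ⋁ᶠ-false⁺ (φ ∘ fs) (f ∘ fs)

  ⋁ⱽ-true⁻ : ∀ {k} n (φ : Vec (Fin k) n → Sentence) → TrueIn S (⋁ⱽ n φ) → ∃ λ v → TrueIn S (φ v)
  ⋁ⱽ-true⁻ zero    φ t = [] , t
  ⋁ⱽ-true⁻ (suc n) φ t =
    let (c , t′) = ⋁ᶠ-true⁻ _ t ; (v , t″) = ⋁ⱽ-true⁻ n (φ ∘ (c ∷_)) t′ in c ∷ v , t″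

  ⋁ⱽ-true⁺ : ∀ {k} n (φ : Vec (Fin k) n → Sentence) v → TrueIn S (φ v) → TrueIn S (⋁ⱽ n φ)
  ⋁ⱽ-true⁺ zero    φ []      t = t
  ⋁ⱽ-true⁺ (suc n) φ (c ∷ v) t = ⋁ᶠ-true⁺ _ c (⋁ⱽ-true⁺ n (φ ∘ (c ∷_)) v t)

  ⋁ⱽ-false⁺ : ∀ {k} n (φ : Vec (Fin k) n → Sentence) → (∀ v → FalseIn S (φ v)) → FalseIn S (⋁ⱽ n φ)
  ⋁ⱽ-false⁺ zero    φ f = f []
  ⋁ⱽ-false⁺ (suc n) φ f = ⋁ᶠ-false⁺ _ λ c → ⋁ⱽ-false⁺ n (φ ∘ (c ∷_)) (f ∘ (c ∷_))

  guarded-true⁻ : ∀ {P : Set} (P? : Dec P) φ → TrueIn S (guarded P? φ) → P × TrueIn S φ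
  guarded-true⁻ (yes p) φ t = p , t

  guarded-true⁺ : ∀ {P : Set} (P? : Dec P) φ → P → TrueIn S φ → TrueIn S (guarded P? φ)
  guarded-true⁺ (yes _) φ _ t = t
  guarded-true⁺ (no ¬p) φ p _ = ⊥-elim (¬p p)

  guarded-false⁺ : ∀ {P : Set} (P? : Dec P) φ → (P → FalseIn S φ) → FalseIn S (guarded P? φ)
  guarded-false⁺ (yes p) φ f = f p
  guarded-false⁺ (no _)  φ _ = λ ()

  module _ (φ ψ χ : Sentence) where
    pick-true-left : TrueIn S φ → TrueIn S (pick φ ψ χ)
    pick-true-left = inj₁

    pick-true-right : FalseIn S ψ → TrueIn S χ → TrueIn S (pick φ ψ χ)
    pick-true-right f t = inj₂ (f , t)

    pick-false-left : FalseIn S φ → TrueIn S ψ → FalseIn S (pick φ ψ χ)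
    pick-false-left f t = f , inj₁ t

    pick-false-right : FalseIn S φ → FalseIn S χ → FalseIn S (pick φ ψ χ)
    pick-false-right f f′ = f , inj₂ f′

    pick-neither : ¬ TrueIn S φ → ¬ TrueIn S ψ → ¬ TrueIn S χ × ¬ FalseIn S χ →
                   ¬ TrueIn S (pick φ ψ χ) × ¬ FalseIn S (pick φ ψ χ)
    pick-neither ¬tφ ¬tψ (¬tχ , ¬fχ) =
      (λ { (inj₁ t) → ¬tφ t ; (inj₂ (_ , t)) → ¬tχ t }) ,
      (λ { (_ , inj₁ t) → ¬tψ t ; (_ , inj₂ f) → ¬fχ f })

const : Fin 3 → Sentence
const fz           = ⊤ₛ
const (fs fz)      = ⊥ₛ
const (fs (fs fz)) = σ 0

const-value : ∀ w c → HasValue w (const c) c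
const-value w fz           = refl
const-value w (fs fz)      = λ ()
const-value w (fs (fs fz)) = σ₀-not-true w , σ₀-not-false w

enc : ∀ {n} → Vec (Fin 3) n → ℕ
enc []      = 0
enc (c ∷ v) = pair (toℕ c) (enc v)

enc-injective : ∀ {n} {u v : Vec (Fin 3) n} → enc u ≡ enc v → u ≡ v
enc-injective {u = []}    {[]}    _ = refl
enc-injective {u = c ∷ u} {d ∷ v} e =
  let (c≡d , u≡v) = pair-injective (toℕ c) (enc u) (toℕ d) (enc v) e
  in cong₂ _∷_ (Finₚ.toℕ-injective c≡d) (enc-injective u≡v)

κ : ∀ {n} → Vec (Fin 3) n → Sentence
κ v = σ (suc (enc v))

κ-unique-true : ∀ w {n} (u : Vec (Fin 3) n) → TrueIn (proj₁ w) (κ u) → ∀ v → v ≢ u → FalseIn (proj₁ w) (κ v)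
κ-unique-true w u t v v≢u = σ-unique-true w (enc u) t (enc v) (v≢u ∘ enc-injective)

κ-selecting : ∀ {n} (u : Vec (Fin 3) n) → FIX
κ-selecting u = Select.selecting (enc u)

κ-selecting-true : ∀ {n} (u : Vec (Fin 3) n) → TrueIn (proj₁ (κ-selecting u)) (κ u)
κ-selecting-true u = Select.selected-true (enc u)

κ-selecting-false : ∀ {n} (u : Vec (Fin 3) n) v → v ≢ u → FalseIn (proj₁ (κ-selecting u)) (κ v)
κ-selecting-false u v v≢u = Select.others-false (enc u) (enc v) (v≢u ∘ enc-injective)

module Construction {n} (S : Vec (Fin 3) n → Bool) {c} (least : Least S c) where

  Member : Fin 3 → Fin n → Vec (Fin 3) n → Set
  Member k j v = S v ≡ true × lookup v j ≡ k

  member? : ∀ k j v → Dec (Member k j v)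
  member? k j v = (S v Boolₚ.≟ true) ×-dec (lookup v j Finₚ.≟ k)

  G : Fin 3 → Fin n → Sentence
  G k j = ⋁ⱽ n λ v → guarded (member? k j v) (κ v)

  -- Y j takes the value of the selected member at j, and the value of c at j
  -- when no member of S is selected.
  Y : Fin n → Sentence
  Y j = pick (G one j) (G two j) (const (lookup c j))

  module _ (w : FIX) where
    private
      Sw : ℕ → Set
      Sw = proj₁ w

    G-true⁻ : ∀ k j → TrueIn Sw (G k j) → ∃ λ v → Member k j v × TrueIn Sw (κ v)
    G-true⁻ k j t =
      let (v , t′) = ⋁ⱽ-true⁻ n _ t in v , guarded-true⁻ (member? k j v) (κ v) t′

    G-true⁺ : ∀ k j v → Member k j v → TrueIn Sw (κ v) → TrueIn Sw (G k j)
    G-true⁺ k j v mv t = ⋁ⱽ-true⁺ n _ v (guarded-true⁺ (member? k j v) (κ v) mv t)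

    G-false⁺ : ∀ k j → (∀ v → Member k j v → FalseIn Sw (κ v)) → FalseIn Sw (G k j)
    G-false⁺ k j f = ⋁ⱽ-false⁺ n _ λ v → guarded-false⁺ (member? k j v) (κ v) (f v)

    G-not-true : ∀ k j → (∀ v → Member k j v → ¬ TrueIn Sw (κ v)) → ¬ TrueIn Sw (G k j)
    G-not-true k j ¬t t = let (v , mv , tv) = G-true⁻ k j t in ¬t v mv tv

    G-false-vacuous : ∀ k j {cⱼ} → lookup c j ≡ cⱼ → cⱼ ≢ three → cⱼ ≢ k → FalseIn Sw (G k j)
    G-false-vacuous k j cj c≢3 c≢k = G-false⁺ k j λ v (Sv , vj≡k) →
      ⊥-elim ([ c≢3 ∘ trans (sym cj) , (λ c≡v → c≢k (trans (sym cj) (trans c≡v vj≡k))) ]′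
                (proj₂ least v Sv j))

    Y-selected : ∀ u → S u ≡ true → TrueIn Sw (κ u) → (∀ v → v ≢ u → FalseIn Sw (κ v)) → Realizes w Y u
    Y-selected u Su tu others j = value (lookup u j) (lookup c j) refl refl
      where
      unselected : ∀ k → k ≢ lookup u j → ∀ v → Member k j v → FalseIn Sw (κ v)
      unselected k k≢uj v (_ , vj) = others v λ { refl → k≢uj (sym vj) }
      not-true : ∀ k → k ≢ lookup u j → ¬ TrueIn Sw (G k j)
      not-true k k≢uj = G-not-true k j λ v m tv → ¬true×false w (κ v) tv (unselected k k≢uj v m)
      value : ∀ uⱼ cⱼ → lookup u j ≡ uⱼ → lookup c j ≡ cⱼ →
              HasValue w (pick (G one j) (G two j) (const cⱼ)) uⱼ
      value fz           cⱼ uj _ = pick-true-left (G one j) (G two j) (const cⱼ) (G-true⁺ one j u (Su , uj) tu)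
      value (fs fz)      cⱼ uj _ = pick-false-left (G one j) (G two j) (const cⱼ)
                                     (G-false⁺ one j (unselected one λ e → contradiction (trans e uj) λ ()))
                                     (G-true⁺ two j u (Su , uj) tu)
      value (fs (fs fz)) cⱼ uj cj with trans (sym cj) (⊑-three (subst (lookup c j ⊑_) uj (proj₂ least u Su j)))
      ... | refl = pick-neither (G one j) (G two j) (const three)
                     (not-true one λ e → contradiction (trans e uj) λ ())
                     (not-true two λ e → contradiction (trans e uj) λ ())
                     (const-value w three)

    Y-default : (∀ v → S v ≡ true → ¬ TrueIn Sw (κ v)) → Realizes w Y c
    Y-default none j = value (lookup c j) refl
      where
      not-true : ∀ k → ¬ TrueIn Sw (G k j)
      not-true k = G-not-true k j λ v (Sv , _) → none v Sv
      value : ∀ cⱼ → lookup c j ≡ cⱼ → HasValue w (pick (G one j) (G two j) (const cⱼ)) cⱼ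
      value fz           cj = pick-true-right (G one j) (G two j) ⊤ₛ (G-false-vacuous two j cj (λ ()) (λ ())) refl
      value (fs fz)      cj = pick-false-right (G one j) (G two j) ⊥ₛ (G-false-vacuous one j cj (λ ()) (λ ())) (λ ())
      value (fs (fs fz)) _  = pick-neither (G one j) (G two j) (σ 0) (not-true one) (not-true two) (const-value w three)

  realized∈S : ∀ w a → Realizes w Y a → S a ≡ true
  realized∈S w a ra = decidable-stable (S a Boolₚ.≟ true) λ Sa≢true →
    excluded-middle λ
      { (inj₁ (u , tu)) → Sa≢true (selected u tu)
      ; (inj₂ none)     → Sa≢true (default λ v _ → none v) }
    where
    Sw : ℕ → Set
    Sw = proj₁ w
    excluded-middle : ¬ ¬ ((∃ λ u → TrueIn Sw (κ u)) ⊎ (∀ u → ¬ TrueIn Sw (κ u)))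
    excluded-middle k = k (inj₂ λ u t → k (inj₁ (u , t)))
    default : (∀ v → S v ≡ true → ¬ TrueIn Sw (κ v)) → S a ≡ true
    default none = subst (λ b → S b ≡ true) (sym (Realizes-unique w Y a c ra (Y-default w none))) (proj₁ least)
    selected : ∀ u → TrueIn Sw (κ u) → S a ≡ true
    selected u tu with S u in Su
    ... | true  = subst (λ b → S b ≡ true) (sym (Realizes-unique w Y a u ra (Y-selected w u Su tu others))) Su
      where
      others : ∀ v → v ≢ u → FalseIn Sw (κ v)
      others = κ-unique-true w u tu
    ... | false = default λ v Sv tv →
      ¬true×false w (κ v) tv (κ-unique-true w u tu v λ { refl → contradiction (trans (sym Sv) Su) λ () })

  selecting-realizes : ∀ u → S u ≡ true → Realizes (κ-selecting u) Y u
  selecting-realizes u Su = Y-selected (κ-selecting u) u Su (κ-selecting-true u) (κ-selecting-false u)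

realize-along : ∀ {m} (x : Fin (suc m) → ℕ) → Injective _≡_ _≡_ x → (Y : Fin (suc m) → Sentence) →
                Σ Realization λ ⋆ → ∀ i → ⋆ (x i) ≡ Y i
realize-along x x-inj Y = ⋆ , ⋆∘x
  where
  ⋆ : Realization
  ⋆ y with Finₚ.any? (λ i → x i ≟ y)
  ... | yes (i , _) = Y i
  ... | no _        = ⊥ₛ
  ⋆∘x : ∀ i → ⋆ (x i) ≡ Y i
  ⋆∘x i with Finₚ.any? (λ j → x j ≟ x i)
  ... | yes (j , xj≡xi) = cong Y (x-inj xj≡xi)
  ... | no  none        = ⊥-elim (none (i , refl))

Characterizes : ∀ {m} → (Fin (suc m) → ℕ) → (Vec (Fin 3) (suc m) → Bool) → Realization → Set₁
Characterizes {m} x S ⋆ = (w : FIX) →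
  ((a : Vec (Fin 3) (suc m)) → S a ≡ true → w ⊩[ ⋆ ] (◇ (ε x a)))
  × ((a : Vec (Fin 3) (suc m)) → S a ≡ false → w ⊩[ ⋆ ] (¬ₘ (◇ (ε x a))))

realization⇒least : ∀ {m} (x : Fin (suc m) → ℕ) S ⋆ → Characterizes x S ⋆ → ∃ (Least S)
realization⇒least x S ⋆ characterizes = realizations⇒least (⋆ ∘ x) S realizable realized∈S
  where
  realizable : ∀ a → S a ≡ true → ¬ ¬ ∃ λ v → Realizes v (⋆ ∘ x) a
  realizable a Sa k = proj₁ (characterizes least-fixpoint) a Sa λ v ⊩ε → k (v , ⊩ε⇒Realizes v ⋆ x a ⊩ε)
  realized∈S : ∀ v a → Realizes v (⋆ ∘ x) a → S a ≡ true
  realized∈S v a r with S a in Sa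
  ... | true  = refl
  ... | false = ⊥-elim (proj₂ (characterizes v) a Sa λ □¬ε → □¬ε v (Realizes⇒⊩ε v ⋆ x a r))

least⇒realization : ∀ {m} (x : Fin (suc m) → ℕ) → Injective _≡_ _≡_ x → ∀ S → ∃ (Least S) →
                    Σ Realization (Characterizes x S)
least⇒realization x x-inj S (c , least) = ⋆ , λ w → possible w , impossible w
  where
  open Construction S least
  ⋆ : Realization
  ⋆ = proj₁ (realize-along x x-inj Y)
  ⋆∘x≡Y : ∀ i → ⋆ (x i) ≡ Y i
  ⋆∘x≡Y = proj₂ (realize-along x x-inj Y)
  along : ∀ w a → Realizes w Y a → Realizes w (⋆ ∘ x) a
  along w a r i = subst (λ φ → HasValue w φ (lookup a i)) (sym (⋆∘x≡Y i)) (r i)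
  back : ∀ w a → Realizes w (⋆ ∘ x) a → Realizes w Y a
  back w a r i = subst (λ φ → HasValue w φ (lookup a i)) (⋆∘x≡Y i) (r i)
  possible : ∀ w a → S a ≡ true → w ⊩[ ⋆ ] (◇ (ε x a))
  possible _ a Sa □¬ε =
    □¬ε (κ-selecting a) (Realizes⇒⊩ε _ ⋆ x a (along (κ-selecting a) a (selecting-realizes a Sa)))
  impossible : ∀ w a → S a ≡ false → w ⊩[ ⋆ ] (¬ₘ (◇ (ε x a)))
  impossible _ a Sa ¬□¬ε = ¬□¬ε λ v ⊩ε →
    contradiction (trans (sym (realized∈S v a (back v a (⊩ε⇒Realizes v ⋆ x a ⊩ε)))) Sa) λ ()

mainTheorem15 : (m : ℕ) (x : Fin (suc m) → ℕ) → Injective _≡_ _≡_ x →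
    (S : Vec (Fin 3) (suc m) → Bool) →
    PrimeConditions S ⇔
      Σ Realization (λ ⋆ → (w : FIX) →
        ((a : Vec (Fin 3) (suc m)) → S a ≡ true → w ⊩[ ⋆ ] (◇ (ε x a)))
        × ((a : Vec (Fin 3) (suc m)) → S a ≡ false → w ⊩[ ⋆ ] (¬ₘ (◇ (ε x a)))))
mainTheorem15 m x x-inj S = mk⇔
  (λ prime → least⇒realization x x-inj S (primeConditions⇒least prime))
  (λ (⋆ , characterizes) → least⇒primeConditions (proj₂ (realization⇒least x S ⋆ characterizes)))
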